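{- Let $A,m\in\mathbb Z$ and let $p$ be an odd prime with $p\nmid m$. Suppose that $\delta\in\mathbb Z$ satisfies $\delta^2\equiv A^2-4m^2\not\equiv0\pmod p$. Let $a,h$ be positive integers. If $\left(\frac{A+\delta}{p^a}\right)=\left(\frac{2m}{p^a}\right)$, then $$\sum_{k=0}^{p^a-1}\frac{u_k(A,m^2)\binom{2k}k^h}{m^k(-4)^{hk}}\equiv0\pmod p.$$ If $\left(\frac{A+\delta}{p^a}\right)=-\left(\frac{2m}{p^a}\right)$, then $$\sum_{k=0}^{p^a-1}\frac{v_k(A,m^2)\binom{2k}k^h}{m^k(-4)^{hk}}\equiv0\pmod p.$$
   Context: For $A,B\in\mathbb Z$ the Lucas sequences are defined by $u_0=0$, $u_1=1$, $u_{n+1}=Au_n-Bu_{n-1}$ and $v_0=2$, $v_1=A$, $v_{n+1}=Av_n-Bv_{n-1}$ ($n\ge1$); we write $u_n(A,B)$, $v_n(A,B)$. $\left(\frac{\cdot}{p^a}\right)$ denotes the Jacobi symbol. Congruences between rationals whose denominators are prime to $p$ are understood in the ring of rationals with denominators prime to $p$. -}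

module Defs where

open import Data.Nat as ℕ using (ℕ; zero; suc)
open import Data.Nat.Divisibility as ℕD using (_∣?_)
open import Data.Integer as ℤ using (ℤ; +_; -_; _-_; _*_; ∣_∣)
open import Data.Integer.Divisibility using (_∣_)
open import Data.Fin using (Fin; toℕ)
open import Data.Fin.Properties using (any?)
open import Data.Product using (_×_; _,_; proj₁; ∃)
open import Relation.Nullary using (¬_; yes; no)
open import Data.Rational as ℚ using (ℚ; 0ℚ; 1/_; ≢-nonZero)
open import Data.Rational.Properties using (_≟_)

private
  step : ℤ → ℤ → ℤ × ℤ → ℤ × ℤ
  step A B (x , y) = (y , A * y - B * x)

  iter : ℤ → ℤ → ℤ × ℤ → ℕ → ℤ × ℤ
  iter A B s zero = s
  iter A B s (suc n) = step A B (iter A B s n)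

lucasU : ℤ → ℤ → ℕ → ℤ
lucasU A B n = proj₁ (iter A B (+ 0 , + 1) n)

lucasV : ℤ → ℤ → ℕ → ℤ
lucasV A B n = proj₁ (iter A B (+ 2 , A) n)

legendre : ℤ → ℕ → ℤ
legendre x p with p ℕD.∣? ∣ x ∣
... | yes _ = + 0
... | no _ with any? {n = p} (λ (y : Fin p) → p ℕD.∣? ∣ (+ toℕ y) * (+ toℕ y) - x ∣)
...   | yes _ = + 1
...   | no _ = - (+ 1)

jacobiPrimePow : ℤ → ℕ → ℕ → ℤ
jacobiPrimePow x p a = legendre x p ℤ.^ a

toℚ : ℤ → ℚ
toℚ n = n ℚ./ 1

-- total inverse (0⁻¹ = 0); only applied to nonzero denominators below
inv : ℚ → ℚ
inv q with q ≟ 0ℚ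
... | yes _ = 0ℚ
... | no q≢0 = 1/_ q {{≢-nonZero q≢0}}

frac : ℤ → ℤ → ℚ
frac n d = toℚ n ℚ.* inv (toℚ d)

sumTo : ℕ → (ℕ → ℚ) → ℚ
sumTo zero f = 0ℚ
sumTo (suc n) f = sumTo n f ℚ.+ f n

-- x ≡ 0 (mod p) in the ring of rationals with denominators prime to p
≡0modℚ : ℚ → ℕ → Set
≡0modℚ x p = ∃ λ (a : ℤ) → ∃ λ (b : ℤ) →
  (¬ (+ p ∣ b)) × (+ p ∣ a) × (x ℚ.≃ frac a b)

-- Work modulo p = 2n + 1. Put α, β = (A ± δ)/2, the roots of X² − AX + m², and x = α/m, y = β/m, so that
-- xy ≡ 1 and, by Binet, δ·u_k/m^k ≡ x^k − y^k and v_k/m^k ≡ x^k + y^k. With b_k = C(2k,k)/(−4)^k the sums become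
-- S(x) ∓ S(y) for S(t) = ∑_{k<p^a} b_k^h t^k. Lucas' theorem makes b_k multiplicative in the base-p digits of k,
-- so by Fermat S(t) ≡ (∑_{k<p} b_k^h t^k)^a; as b_j ≡ C(n,j) for j < p, this is F(t)^a for the palindromic
-- F(t) = ∑_{j≤n} C(n,j)^h t^j, whence S(x) ≡ (x^n)^a S(y). Euler's criterion, proved through Wilson's pairing
-- t ↦ g/t, gives x^n ≡ (2m/p)((A+δ)/p), so (x^n)^a ≡ ±1 under the respective hypothesis and S(x) ∓ S(y) ≡ 0.

module Submission where

open import Data.Nat as ℕ using (ℕ)
open import Data.Integer as ℤ using (ℤ)
open import Data.Nat.Primality using (Prime)

module Binomial where

  open import Data.Nat using (zero; suc; _+_; _*_; _∸_; s≤s; z≤n)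
  open import Data.Nat.Properties
    using (+-identityʳ; *-zeroʳ; *-identityʳ; *-distribˡ-+; *-cancelˡ-≡; <-cmp; +-∸-assoc; n<1+n; m<n⇒m<1+n;
           m≤m+n; +-comm; m+n∸n≡m)
  open import Data.Nat.Combinatorics using (_C_; k>n⇒nCk≡0; nC1≡n; nCk+nC[k+1]≡[n+1]C[k+1]; nCk≡nC[n∸k])
  open import Data.Nat.Tactic.RingSolver using (solve-∀)
  open import Relation.Binary.PropositionalEquality using (_≡_; refl; sym; trans; cong; cong₂; module ≡-Reasoning)
  open import Relation.Binary.Definitions using (tri<; tri≈; tri>)
  open ≡-Reasoning

  pascal : ∀ m k → suc m C suc k ≡ m C k + m C suc k
  pascal m k = sym (nCk+nC[k+1]≡[n+1]C[k+1] m k)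

  [k+1]*[m+1]C[k+1]≡[m+1]*mCk : ∀ m k → suc k * (suc m C suc k) ≡ suc m * (m C k)
  [k+1]*[m+1]C[k+1]≡[m+1]*mCk zero zero = refl
  [k+1]*[m+1]C[k+1]≡[m+1]*mCk zero (suc k) rewrite k>n⇒nCk≡0 {1} {suc (suc k)} (s≤s (s≤s z≤n)) =
    *-zeroʳ (suc (suc k))
  [k+1]*[m+1]C[k+1]≡[m+1]*mCk (suc m) zero rewrite nC1≡n (suc (suc m)) =
    trans (+-identityʳ _) (sym (*-identityʳ _))
  [k+1]*[m+1]C[k+1]≡[m+1]*mCk (suc m) (suc k) = begin
    (2 + k) * (suc (suc m) C suc (suc k)) ≡⟨ cong ((2 + k) *_) (pascal (suc m) (suc k)) ⟩
    (2 + k) * (a + b)                     ≡⟨ expand a b k ⟩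
    a + (1 + k) * a + (2 + k) * b         ≡⟨ cong₂ (λ u v → a + u + v) ([k+1]*[m+1]C[k+1]≡[m+1]*mCk m k)
                                                                       ([k+1]*[m+1]C[k+1]≡[m+1]*mCk m (suc k)) ⟩
    a + (1 + m) * c + (1 + m) * d         ≡⟨ collect a c d m ⟩
    a + (1 + m) * (c + d)                 ≡⟨ cong (λ u → a + (1 + m) * u) (sym (pascal m k)) ⟩
    a + (1 + m) * a                       ≡⟨⟩
    (2 + m) * a                           ∎
    where
    a = suc m C suc k
    b = suc m C suc (suc k)
    c = m C k
    d = m C suc k
    expand : ∀ a b k → (2 + k) * (a + b) ≡ a + (1 + k) * a + (2 + k) * b
    expand = solve-∀
    collect : ∀ a c d m → a + (1 + m) * c + (1 + m) * d ≡ a + (1 + m) * (c + d)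
    collect = solve-∀

  [k+1]*mC[k+1]≡[m∸k]*mCk : ∀ m k → suc k * (m C suc k) ≡ (m ∸ k) * (m C k)
  [k+1]*mC[k+1]≡[m∸k]*mCk zero zero = refl
  [k+1]*mC[k+1]≡[m∸k]*mCk zero (suc k) = *-zeroʳ (suc (suc k))
  [k+1]*mC[k+1]≡[m∸k]*mCk (suc m) zero rewrite nC1≡n (suc m) = trans (+-identityʳ _) (sym (*-identityʳ _))
  [k+1]*mC[k+1]≡[m∸k]*mCk (suc m) (suc k) = begin
    (2 + k) * (suc m C suc (suc k))    ≡⟨ cong ((2 + k) *_) (pascal m (suc k)) ⟩
    (2 + k) * (b + c)                  ≡⟨ expand b c k ⟩
    (1 + k) * b + (b + (2 + k) * c)    ≡⟨ cong (λ u → (1 + k) * b + (b + u)) ([k+1]*mC[k+1]≡[m∸k]*mCk m (suc k)) ⟩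
    (1 + k) * b + (b + (m ∸ suc k) * b) ≡⟨ cong₂ _+_ ([k+1]*mC[k+1]≡[m∸k]*mCk m k) absorb ⟩
    (m ∸ k) * a + (m ∸ k) * b          ≡⟨ sym (*-distribˡ-+ (m ∸ k) a b) ⟩
    (m ∸ k) * (a + b)                  ≡⟨ cong ((m ∸ k) *_) (sym (pascal m k)) ⟩
    (m ∸ k) * (suc m C suc k)          ∎
    where
    a = m C k
    b = m C suc k
    c = m C suc (suc k)
    expand : ∀ b c k → (2 + k) * (b + c) ≡ (1 + k) * b + (b + (2 + k) * c)
    expand = solve-∀
    absorb : b + (m ∸ suc k) * b ≡ (m ∸ k) * b
    absorb with <-cmp k m
    ... | tri< k<m _ _ = cong (_* b) (sym (+-∸-assoc 1 k<m))
    ... | tri≈ _ refl _ rewrite k>n⇒nCk≡0 {m} {suc m} (n<1+n m) =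
      trans (*-zeroʳ (m ∸ suc m)) (sym (*-zeroʳ (m ∸ m)))
    ... | tri> _ _ k>m rewrite k>n⇒nCk≡0 {m} {suc k} (m<n⇒m<1+n k>m) =
      trans (*-zeroʳ (m ∸ suc k)) (sym (*-zeroʳ (m ∸ k)))

  [j+1]*[2j+2]C[j+1]≡2[2j+1]*[2j]Cj : ∀ j → suc j * ((2 * suc j) C suc j) ≡ 2 * suc (2 * j) * ((2 * j) C j)
  [j+1]*[2j+2]C[j+1]≡2[2j+1]*[2j]Cj j = *-cancelˡ-≡ _ _ (suc j) (begin
    suc j * (suc j * ((2 * suc j) C suc j)) ≡⟨ cong (λ z → suc j * (suc j * (z C suc j))) (double-suc j) ⟩
    suc j * (suc j * ((2 + m) C suc j))     ≡⟨ cong (suc j *_) ([k+1]*[m+1]C[k+1]≡[m+1]*mCk (suc m) j) ⟩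
    suc j * ((2 + m) * (suc m C j))         ≡⟨ swap (suc j) (2 + m) (suc m C j) ⟩
    (2 + m) * (suc j * (suc m C j))         ≡⟨ cong (λ z → (2 + m) * (suc j * z)) (sym symmetric) ⟩
    (2 + m) * (suc j * (suc m C suc j))     ≡⟨ cong ((2 + m) *_) ([k+1]*[m+1]C[k+1]≡[m+1]*mCk m j) ⟩
    (2 + m) * (suc m * (m C j))             ≡⟨ regroup j (m C j) ⟩
    suc j * (2 * suc (2 * j) * (m C j))     ∎)
    where
    m = 2 * j
    double-suc : ∀ j → 2 * suc j ≡ 2 + 2 * j
    double-suc = solve-∀
    symmetric : suc m C suc j ≡ suc m C j
    symmetric = trans (nCk≡nC[n∸k] (s≤s (m≤m+n j (j + 0))))
                      (cong (suc m C_) (trans (cong (_∸ j) (+-comm j (j + 0))) (trans (m+n∸n≡m (j + 0) j) (+-identityʳ j))))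
    swap : ∀ a b c → a * (b * c) ≡ b * (a * c)
    swap = solve-∀
    regroup : ∀ j c → (2 + 2 * j) * ((1 + 2 * j) * c) ≡ (1 + j) * (2 * (1 + 2 * j) * c)
    regroup = solve-∀

module Fractions where

  open import Data.Nat using (suc)
  import Data.Nat.Coprimality as Coprimality
  open import Data.Integer using (ℤ; +_; -[1+_]; _+_; _*_; 0ℤ; 1ℤ; ∣_∣)
  open import Data.Integer.Tactic.RingSolver using (solve-∀)
  open import Data.Rational as ℚ using (ℚ; mkℚ; 0ℚ; 1ℚ; 1/_; ≢-nonZero)
  import Data.Rational.Properties as ℚ
  import Data.Rational.Unnormalised as ℚᵘ
  import Data.Rational.Unnormalised.Properties as ℚᵘ
  import Data.Integer.Properties as ℤ
  open import Data.Empty using (⊥-elim)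
  open import Data.Sum using ([_,_]′)
  open import Relation.Nullary using (yes; no)
  open import Relation.Binary.PropositionalEquality
    using (_≡_; _≢_; refl; sym; trans; cong; cong₂; module ≡-Reasoning)
  open import Defs using (toℚ; inv; frac)
  open ≡-Reasoning

  private
    coprime-1 : ∀ k → Coprimality.Coprime k 1
    coprime-1 k = Coprimality.sym (Coprimality.1-coprimeTo k)

    toℚ≡mkℚ : ∀ i → toℚ i ≡ mkℚ i 0 (coprime-1 ∣ i ∣)
    toℚ≡mkℚ (+ k) = ℚ.normalize-coprime (coprime-1 k)
    toℚ≡mkℚ -[1+ k ] = cong ℚ.-_ (ℚ.normalize-coprime (coprime-1 (suc k)))

  toℚ-+ : ∀ a b → toℚ (a + b) ≡ toℚ a ℚ.+ toℚ b
  toℚ-+ a b rewrite toℚ≡mkℚ (a + b) | toℚ≡mkℚ a | toℚ≡mkℚ b =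
    ℚ.toℚᵘ-injective (ℚᵘ.≃-trans (ℚᵘ.*≡* (over-1 a b))
      (ℚᵘ.≃-sym (ℚ.toℚᵘ-homo-+ (mkℚ a 0 (coprime-1 ∣ a ∣)) (mkℚ b 0 (coprime-1 ∣ b ∣)))))
    where
    over-1 : ∀ a b → (a + b) * 1ℤ ≡ (a * 1ℤ + b * 1ℤ) * 1ℤ
    over-1 = solve-∀

  toℚ-* : ∀ a b → toℚ (a * b) ≡ toℚ a ℚ.* toℚ b
  toℚ-* a b rewrite toℚ≡mkℚ (a * b) | toℚ≡mkℚ a | toℚ≡mkℚ b =
    ℚ.toℚᵘ-injective (ℚᵘ.≃-sym (ℚ.toℚᵘ-homo-* (mkℚ a 0 (coprime-1 ∣ a ∣)) (mkℚ b 0 (coprime-1 ∣ b ∣))))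

  toℚ-≢0 : ∀ {b} → b ≢ 0ℤ → toℚ b ≢ 0ℚ
  toℚ-≢0 {b} b≢0 eq = b≢0 (cong ℚ.numerator (trans (sym (toℚ≡mkℚ b)) eq))

  inv≡1/ : ∀ q (q≢0 : q ≢ 0ℚ) → inv q ≡ (1/ q) {{≢-nonZero q≢0}}
  inv≡1/ q q≢0 with q ℚ.≟ 0ℚ
  ... | yes q≡0 = ⊥-elim (q≢0 q≡0)
  ... | no _ = refl

  frac-*-den : ∀ a {b} → b ≢ 0ℤ → frac a b ℚ.* toℚ b ≡ toℚ a
  frac-*-den a {b} b≢0 = begin
    (toℚ a ℚ.* inv (toℚ b)) ℚ.* toℚ b ≡⟨ ℚ.*-assoc (toℚ a) (inv (toℚ b)) (toℚ b) ⟩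
    toℚ a ℚ.* (inv (toℚ b) ℚ.* toℚ b) ≡⟨ cong (λ z → toℚ a ℚ.* (z ℚ.* toℚ b)) (inv≡1/ (toℚ b) tb≢0) ⟩
    toℚ a ℚ.* ((1/ toℚ b) {{≢-nonZero tb≢0}} ℚ.* toℚ b)
      ≡⟨ cong (toℚ a ℚ.*_) (ℚ.*-inverseˡ (toℚ b) {{≢-nonZero tb≢0}}) ⟩
    toℚ a ℚ.* 1ℚ                       ≡⟨ ℚ.*-identityʳ (toℚ a) ⟩
    toℚ a                              ∎
    where tb≢0 = toℚ-≢0 b≢0

  ≡frac : ∀ q a {b} → b ≢ 0ℤ → q ℚ.* toℚ b ≡ toℚ a → q ≡ frac a b
  ≡frac q a {b} b≢0 eq = begin
    q                                               ≡⟨ sym (ℚ.*-identityʳ q) ⟩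
    q ℚ.* 1ℚ                                        ≡⟨ cong (q ℚ.*_) (sym (ℚ.*-inverseʳ (toℚ b) {{≢-nonZero tb≢0}})) ⟩
    q ℚ.* (toℚ b ℚ.* (1/ toℚ b) {{≢-nonZero tb≢0}}) ≡⟨ sym (ℚ.*-assoc q (toℚ b) _) ⟩
    (q ℚ.* toℚ b) ℚ.* (1/ toℚ b) {{≢-nonZero tb≢0}} ≡⟨ cong₂ ℚ._*_ eq (sym (inv≡1/ (toℚ b) tb≢0)) ⟩
    toℚ a ℚ.* inv (toℚ b)                           ∎
    where tb≢0 = toℚ-≢0 b≢0

  frac-+ : ∀ a {b} c {d} → b ≢ 0ℤ → d ≢ 0ℤ → frac a b ℚ.+ frac c d ≡ frac (a * d + c * b) (b * d)
  frac-+ a {b} c {d} b≢0 d≢0 = ≡frac (x ℚ.+ y) (a * d + c * b) bd≢0 (begin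
    (x ℚ.+ y) ℚ.* toℚ (b * d)                   ≡⟨ cong ((x ℚ.+ y) ℚ.*_) (toℚ-* b d) ⟩
    (x ℚ.+ y) ℚ.* (tb ℚ.* td)                   ≡⟨ ℚ.*-distribʳ-+ (tb ℚ.* td) x y ⟩
    x ℚ.* (tb ℚ.* td) ℚ.+ y ℚ.* (tb ℚ.* td)
      ≡⟨ cong₂ ℚ._+_ (sym (ℚ.*-assoc x tb td)) (trans (cong (y ℚ.*_) (ℚ.*-comm tb td)) (sym (ℚ.*-assoc y td tb))) ⟩
    (x ℚ.* tb) ℚ.* td ℚ.+ (y ℚ.* td) ℚ.* tb     ≡⟨ cong₂ (λ u v → u ℚ.* td ℚ.+ v ℚ.* tb) (frac-*-den a b≢0) (frac-*-den c d≢0) ⟩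
    toℚ a ℚ.* td ℚ.+ toℚ c ℚ.* tb               ≡⟨ sym (cong₂ ℚ._+_ (toℚ-* a d) (toℚ-* c b)) ⟩
    toℚ (a * d) ℚ.+ toℚ (c * b)                 ≡⟨ sym (toℚ-+ (a * d) (c * b)) ⟩
    toℚ (a * d + c * b)                         ∎)
    where
    bd≢0 : b * d ≢ 0ℤ
    bd≢0 bd≡0 = [ b≢0 , d≢0 ]′ (ℤ.i*j≡0⇒i≡0∨j≡0 b bd≡0)
    x = frac a b
    y = frac c d
    tb = toℚ b
    td = toℚ d

module IntegerSums where

  open import Data.Nat as ℕ using (ℕ; zero; suc)
  import Data.Nat.Properties as ℕ
  open import Data.Integer using (ℤ; -_; _+_; _-_; _*_; 0ℤ)
  import Data.Integer.Properties as ℤ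
  open import Data.Integer.Tactic.RingSolver using (solve-∀)
  open import Relation.Binary.PropositionalEquality using (_≡_; refl; sym; trans; cong; cong₂; module ≡-Reasoning)

  ∑ : ℕ → (ℕ → ℤ) → ℤ
  ∑ zero f = 0ℤ
  ∑ (suc N) f = ∑ N f + f N

  ∑-ext : ∀ N {f g} → (∀ k → k ℕ.< N → f k ≡ g k) → ∑ N f ≡ ∑ N g
  ∑-ext zero f≡g = refl
  ∑-ext (suc N) f≡g = cong₂ _+_ (∑-ext N (λ k k<N → f≡g k (ℕ.m<n⇒m<1+n k<N))) (f≡g N (ℕ.n<1+n N))

  ∑-zero : ∀ N f → (∀ k → k ℕ.< N → f k ≡ 0ℤ) → ∑ N f ≡ 0ℤ
  ∑-zero zero f f≡0 = refl
  ∑-zero (suc N) f f≡0 = cong₂ _+_ (∑-zero N f (λ k k<N → f≡0 k (ℕ.m<n⇒m<1+n k<N))) (f≡0 N (ℕ.n<1+n N))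

  ∑-+ : ∀ N f g → ∑ N (λ k → f k + g k) ≡ ∑ N f + ∑ N g
  ∑-+ zero f g = refl
  ∑-+ (suc N) f g = trans (cong (_+ (f N + g N)) (∑-+ N f g)) (interchange (∑ N f) (∑ N g) (f N) (g N))
    where
    interchange : ∀ a b c d → (a + b) + (c + d) ≡ (a + c) + (b + d)
    interchange = solve-∀

  ∑-neg : ∀ N f → ∑ N (λ k → - f k) ≡ - ∑ N f
  ∑-neg zero f = refl
  ∑-neg (suc N) f = trans (cong (_+ - f N) (∑-neg N f)) (sym (ℤ.neg-distrib-+ (∑ N f) (f N)))

  ∑-- : ∀ N f g → ∑ N (λ k → f k - g k) ≡ ∑ N f - ∑ N g
  ∑-- N f g = trans (∑-+ N f (λ k → - g k)) (cong (∑ N f +_) (∑-neg N g))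

  ∑-*ˡ : ∀ N c f → c * ∑ N f ≡ ∑ N (λ k → c * f k)
  ∑-*ˡ zero c f = ℤ.*-zeroʳ c
  ∑-*ˡ (suc N) c f = trans (ℤ.*-distribˡ-+ c (∑ N f) (f N)) (cong (_+ c * f N) (∑-*ˡ N c f))

  ∑-*ʳ : ∀ N c f → ∑ N f * c ≡ ∑ N (λ k → f k * c)
  ∑-*ʳ N c f = trans (ℤ.*-comm (∑ N f) c) (trans (∑-*ˡ N c f) (∑-ext N (λ k _ → ℤ.*-comm c (f k))))

  ∑-split : ∀ a b f → ∑ (a ℕ.+ b) f ≡ ∑ a f + ∑ b (λ i → f (a ℕ.+ i))
  ∑-split a zero f = trans (cong (λ z → ∑ z f) (ℕ.+-identityʳ a)) (sym (ℤ.+-identityʳ (∑ a f)))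
  ∑-split a (suc b) f = trans (cong (λ z → ∑ z f) (ℕ.+-suc a b))
    (trans (cong (_+ f (a ℕ.+ b)) (∑-split a b f)) (ℤ.+-assoc (∑ a f) (∑ b (λ i → f (a ℕ.+ i))) (f (a ℕ.+ b))))

  ∑-blocks : ∀ N p f → ∑ (N ℕ.* p) f ≡ ∑ N (λ k → ∑ p (λ j → f (k ℕ.* p ℕ.+ j)))
  ∑-blocks zero p f = refl
  ∑-blocks (suc N) p f = trans (cong (λ z → ∑ z f) (ℕ.+-comm p (N ℕ.* p)))
    (trans (∑-split (N ℕ.* p) p f) (cong (_+ ∑ p (λ j → f (N ℕ.* p ℕ.+ j))) (∑-blocks N p f)))

  ∑-reverse : ∀ m f → ∑ (suc m) f ≡ ∑ (suc m) (λ j → f (m ℕ.∸ j))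
  ∑-reverse zero f = refl
  ∑-reverse (suc m) f = begin
    ∑ (2 ℕ.+ m) f                                  ≡⟨ ∑-split 1 (suc m) f ⟩
    (0ℤ + f 0) + ∑ (suc m) (λ i → f (suc i))       ≡⟨ cong (λ z → (0ℤ + f 0) + z) (∑-reverse m (λ i → f (suc i))) ⟩
    (0ℤ + f 0) + ∑ (suc m) (λ j → f (suc (m ℕ.∸ j))) ≡⟨ cong (λ z → (0ℤ + f 0) + z) (∑-ext (suc m) suc-∸) ⟩
    (0ℤ + f 0) + ∑ (suc m) g                       ≡⟨ cong (_+ ∑ (suc m) g) (ℤ.+-identityˡ (f 0)) ⟩
    f 0 + ∑ (suc m) g                              ≡⟨ ℤ.+-comm (f 0) (∑ (suc m) g) ⟩
    ∑ (suc m) g + f 0                              ≡⟨ cong (λ j → ∑ (suc m) g + f j) (ℕ.n∸n≡0 m) ⟨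
    ∑ (2 ℕ.+ m) g                                  ∎
    where
    open ≡-Reasoning
    g = λ j → f (suc m ℕ.∸ j)
    suc-∸ : ∀ j → j ℕ.< suc m → f (suc (m ℕ.∸ j)) ≡ g j
    suc-∸ j j<1+m = cong f (sym (ℕ.+-∸-assoc 1 (ℕ.≤-pred j<1+m)))

module Congruence (p : ℕ) where

  open import Data.Nat as ℕ using (ℕ; zero; suc)
  import Data.Nat.Properties as ℕ
  open import Data.Integer using (ℤ; +_; -_; _+_; _-_; _*_; _^_; 0ℤ; 1ℤ; ∣_∣)
  import Data.Integer.Properties as ℤ
  open import Data.Integer.Divisibility.Signed using (_∣_; divides; ∣m⇒∣-m; ∣m∣n⇒∣m+n; ∣m⇒∣m*n; ∣n⇒∣m*n; ∣ᵤ⇒∣; ∣⇒∣ᵤ)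
  import Data.Nat.Divisibility as ℕ
  open import Data.Integer.Tactic.RingSolver using (solve-∀)
  open import Relation.Nullary using (¬_; Dec; map′)
  open import Function using (_∘_)
  open import Relation.Binary.Bundles using (Setoid)
  open import Relation.Binary.PropositionalEquality using (_≡_; refl; sym; trans; cong; subst)
  import Relation.Binary.Reasoning.Setoid as SetoidReasoning
  open IntegerSums using (∑; ∑-ext; ∑-*ˡ; ∑-*ʳ; ∑-blocks)

  infix 4 _≈_ _≉_
  record _≈_ (x y : ℤ) : Set where
    constructor mk≈
    field ∣-diff : + p ∣ x - y
  open _≈_ public

  _≉_ : ℤ → ℤ → Set
  x ≉ y = ¬ (x ≈ y)

  private
    ≈-via : ∀ {x y t} → x - y ≡ t → + p ∣ t → x ≈ y
    ≈-via eq p∣t = mk≈ (subst (+ p ∣_) (sym eq) p∣t)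

  ∣⇒≈0 : ∀ {x} → + p ∣ x → x ≈ 0ℤ
  ∣⇒≈0 {x} = ≈-via (ℤ.+-identityʳ x)

  ≈0⇒∣ : ∀ {x} → x ≈ 0ℤ → + p ∣ x
  ≈0⇒∣ {x} x≈0 = subst (+ p ∣_) (ℤ.+-identityʳ x) (∣-diff x≈0)

  ≈⇒-≈0 : ∀ {x y} → x ≈ y → x - y ≈ 0ℤ
  ≈⇒-≈0 x≈y = ∣⇒≈0 (∣-diff x≈y)

  -≈0⇒≈ : ∀ {x y} → x - y ≈ 0ℤ → x ≈ y
  -≈0⇒≈ x-y≈0 = mk≈ (≈0⇒∣ x-y≈0)

  ∣ᵤ⇒≈0 : ∀ {x} → p ℕ.∣ ∣ x ∣ → x ≈ 0ℤ
  ∣ᵤ⇒≈0 = ∣⇒≈0 ∘ ∣ᵤ⇒∣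

  ∤ᵤ⇒≉0 : ∀ {x} → ¬ (p ℕ.∣ ∣ x ∣) → x ≉ 0ℤ
  ∤ᵤ⇒≉0 p∤x = p∤x ∘ ∣⇒∣ᵤ ∘ ≈0⇒∣

  ≈0? : ∀ x → Dec (x ≈ 0ℤ)
  ≈0? x = map′ ∣ᵤ⇒≈0 (∣⇒∣ᵤ ∘ ≈0⇒∣) (p ℕ.∣? ∣ x ∣)

  ≡⇒≈ : ∀ {x y} → x ≡ y → x ≈ y
  ≡⇒≈ {x} refl = ≈-via (ℤ.+-inverseʳ x) (divides 0ℤ refl)

  ≈-refl : ∀ {x} → x ≈ x
  ≈-refl = ≡⇒≈ refl

  ≈-sym : ∀ {x y} → x ≈ y → y ≈ x
  ≈-sym {x} {y} x≈y = ≈-via (negate x y) (∣m⇒∣-m (∣-diff x≈y))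
    where
    negate : ∀ x y → y - x ≡ - (x - y)
    negate = solve-∀

  ≈-trans : ∀ {x y z} → x ≈ y → y ≈ z → x ≈ z
  ≈-trans {x} {y} {z} x≈y y≈z = ≈-via (telescope x y z) (∣m∣n⇒∣m+n (∣-diff x≈y) (∣-diff y≈z))
    where
    telescope : ∀ x y z → x - z ≡ (x - y) + (y - z)
    telescope = solve-∀

  ≈-setoid : Setoid _ _
  ≈-setoid = record { Carrier = ℤ ; _≈_ = _≈_ ; isEquivalence = record { refl = ≈-refl ; sym = ≈-sym ; trans = ≈-trans } }

  module ≈-Reasoning = SetoidReasoning ≈-setoid

  +-cong : ∀ {x y u v} → x ≈ y → u ≈ v → x + u ≈ y + v
  +-cong {x} {y} {u} {v} x≈y u≈v = ≈-via (regroup x y u v) (∣m∣n⇒∣m+n (∣-diff x≈y) (∣-diff u≈v))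
    where
    regroup : ∀ x y u v → (x + u) - (y + v) ≡ (x - y) + (u - v)
    regroup = solve-∀

  *-cong : ∀ {x y u v} → x ≈ y → u ≈ v → x * u ≈ y * v
  *-cong {x} {y} {u} {v} x≈y u≈v =
    ≈-via (regroup x y u v) (∣m∣n⇒∣m+n (∣m⇒∣m*n u (∣-diff x≈y)) (∣n⇒∣m*n y (∣-diff u≈v)))
    where
    regroup : ∀ x y u v → (x * u) - (y * v) ≡ (x - y) * u + y * (u - v)
    regroup = solve-∀

  neg-cong : ∀ {x y} → x ≈ y → - x ≈ - y
  neg-cong {x} {y} x≈y = ≈-via (regroup x y) (∣m⇒∣-m (∣-diff x≈y))
    where
    regroup : ∀ x y → (- x) - (- y) ≡ - (x - y)
    regroup = solve-∀

  neg-injective : ∀ {x y} → - x ≈ - y → x ≈ y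
  neg-injective {x} {y} -x≈-y = ≈-trans (≡⇒≈ (sym (ℤ.neg-involutive x))) (≈-trans (neg-cong -x≈-y) (≡⇒≈ (ℤ.neg-involutive y)))

  -‿cong : ∀ {x y u v} → x ≈ y → u ≈ v → x - u ≈ y - v
  -‿cong x≈y u≈v = +-cong x≈y (neg-cong u≈v)

  *-congˡ : ∀ x {y z} → y ≈ z → x * y ≈ x * z
  *-congˡ x = *-cong (≈-refl {x})

  *-congʳ : ∀ x {y z} → y ≈ z → y * x ≈ z * x
  *-congʳ x y≈z = *-cong y≈z (≈-refl {x})

  ^-cong : ∀ {x y} k → x ≈ y → x ^ k ≈ y ^ k
  ^-cong zero x≈y = ≈-refl
  ^-cong (suc k) x≈y = *-cong x≈y (^-cong k x≈y)

  ^-≈0 : ∀ {x} k → 1 ℕ.≤ k → x ≈ 0ℤ → x ^ k ≈ 0ℤ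
  ^-≈0 {x} (suc k) _ x≈0 = ≈-trans (*-congʳ (x ^ k) x≈0) (≡⇒≈ (ℤ.*-zeroˡ (x ^ k)))

  p≈0 : + p ≈ 0ℤ
  p≈0 = ∣⇒≈0 (divides 1ℤ (sym (ℤ.*-identityˡ (+ p))))

  ∑-cong : ∀ N {f g} → (∀ k → k ℕ.< N → f k ≈ g k) → ∑ N f ≈ ∑ N g
  ∑-cong zero f≈g = ≈-refl
  ∑-cong (suc N) f≈g = +-cong (∑-cong N (λ k k<N → f≈g k (ℕ.m<n⇒m<1+n k<N))) (f≈g N (ℕ.n<1+n N))

  ^-distrib-* : ∀ a b k → (a * b) ^ k ≡ a ^ k * b ^ k
  ^-distrib-* a b zero = refl
  ^-distrib-* a b (suc k) = trans (cong ((a * b) *_) (^-distrib-* a b k)) (interchange a b (a ^ k) (b ^ k))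
    where
    interchange : ∀ a b c d → (a * b) * (c * d) ≡ (a * c) * (b * d)
    interchange = solve-∀

  ^-digits : ∀ {x} q → x ^ q ≈ x → ∀ k j → x ^ (k ℕ.* q ℕ.+ j) ≈ x ^ k * x ^ j
  ^-digits {x} q x^q≈x k j = begin
    x ^ (k ℕ.* q ℕ.+ j)   ≡⟨ ℤ.^-distribˡ-+-* x (k ℕ.* q) j ⟩
    x ^ (k ℕ.* q) * x ^ j ≡⟨ cong (_* x ^ j) (trans (cong (x ^_) (ℕ.*-comm k q)) (sym (ℤ.^-*-assoc x q k))) ⟩
    (x ^ q) ^ k * x ^ j   ≈⟨ *-congʳ (x ^ j) (^-cong k x^q≈x) ⟩
    x ^ k * x ^ j         ∎
    where open ≈-Reasoning

  ∑-digit-multiplicative : ∀ q f → f 0 ≈ 1ℤ → (∀ k j → j ℕ.< q → f (k ℕ.* q ℕ.+ j) ≈ f k * f j) →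
                           ∀ a → ∑ (q ℕ.^ a) f ≈ ∑ q f ^ a
  ∑-digit-multiplicative q f f0≈1 f-digits zero = ≈-trans (≡⇒≈ (ℤ.+-identityˡ (f 0))) f0≈1
  ∑-digit-multiplicative q f f0≈1 f-digits (suc a) = begin
    ∑ (q ℕ.* q ℕ.^ a) f                              ≡⟨ cong (λ z → ∑ z f) (ℕ.*-comm q (q ℕ.^ a)) ⟩
    ∑ (q ℕ.^ a ℕ.* q) f                              ≡⟨ ∑-blocks (q ℕ.^ a) q f ⟩
    ∑ (q ℕ.^ a) (λ k → ∑ q (λ j → f (k ℕ.* q ℕ.+ j))) ≈⟨ ∑-cong (q ℕ.^ a) (λ k _ → ∑-cong q (λ j j<q → f-digits k j j<q)) ⟩
    ∑ (q ℕ.^ a) (λ k → ∑ q (λ j → f k * f j))         ≡⟨ ∑-ext (q ℕ.^ a) (λ k _ → sym (∑-*ˡ q (f k) f)) ⟩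
    ∑ (q ℕ.^ a) (λ k → f k * ∑ q f)                   ≡⟨ ∑-*ʳ (q ℕ.^ a) (∑ q f) f ⟨
    ∑ (q ℕ.^ a) f * ∑ q f                             ≈⟨ *-congʳ (∑ q f) (∑-digit-multiplicative q f f0≈1 f-digits a) ⟩
    ∑ q f ^ a * ∑ q f                                 ≡⟨ ℤ.*-comm (∑ q f ^ a) (∑ q f) ⟩
    ∑ q f * ∑ q f ^ a                                 ∎
    where open ≈-Reasoning

module InvolutionProducts (p : ℕ) where

  open import Data.Nat as ℕ using (ℕ; suc)
  import Data.Nat.Properties as ℕ
  open import Data.Integer using (ℤ; +_; _*_; _^_; 1ℤ)
  open import Data.Integer.Tactic.RingSolver using (solve-∀)
  open import Data.Product using (_×_; _,_; ∃; proj₁; proj₂)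
  open import Data.Empty using (⊥-elim)
  open import Data.List using (List; []; _∷_; length; filter)
  open import Data.List.Relation.Unary.Any using (here; there)
  open import Data.List.Relation.Unary.All as All using ()
  open import Data.List.Relation.Unary.AllPairs using (_∷_)
  open import Data.List.Relation.Unary.Unique.Propositional using (Unique)
  open import Data.List.Relation.Unary.Unique.Propositional.Properties using (filter⁺)
  open import Data.List.Membership.Propositional using (_∈_)
  open import Data.List.Membership.Propositional.Properties using (∈-filter⁺; ∈-filter⁻)
  open import Data.List.Properties using (filter-all; filter-accept; filter-reject)
  open import Relation.Nullary using (yes; no; ¬?)
  open import Relation.Binary.PropositionalEquality using (_≡_; _≢_; ≢-sym; refl; sym; trans; cong; subst)
  open Congruence p
  open ≈-Reasoning

  ∏ : List ℕ → ℤ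
  ∏ [] = 1ℤ
  ∏ (t ∷ L) = + t * ∏ L

  _without_ : List ℕ → ℕ → List ℕ
  L without a = filter (λ b → ¬? (b ℕ.≟ a)) L

  ∈-without⁻ : ∀ {a t} L → t ∈ L without a → t ∈ L × t ≢ a
  ∈-without⁻ {a} L = ∈-filter⁻ (λ b → ¬? (b ℕ.≟ a)) {xs = L}

  ∈-without⁺ : ∀ {a t} L → t ∈ L → t ≢ a → t ∈ L without a
  ∈-without⁺ {a} L = ∈-filter⁺ (λ b → ¬? (b ℕ.≟ a)) {xs = L}

  without-unique : ∀ {a} L → Unique L → Unique (L without a)
  without-unique {a} L = filter⁺ (λ b → ¬? (b ℕ.≟ a)) {xs = L}

  without-∉ : ∀ {a} L → All.All (a ≢_) L → L without a ≡ L
  without-∉ {a} L a∉L = filter-all (λ t → ¬? (t ℕ.≟ a)) (All.map ≢-sym a∉L)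

  ∏-without : ∀ {a} L → Unique L → a ∈ L → ∏ L ≡ + a * ∏ (L without a) × length L ≡ suc (length (L without a))
  ∏-without {a} (b ∷ L) (b∉L ∷ u) a∈bL with b ℕ.≟ a
  ... | yes refl rewrite filter-reject (λ t → ¬? (t ℕ.≟ b)) {b} {L} (λ b≢b → b≢b refl) | without-∉ L b∉L =
    refl , refl
  ... | no b≢a with a∈bL
  ...   | here a≡b = ⊥-elim (b≢a (sym a≡b))
  ...   | there a∈L rewrite filter-accept (λ t → ¬? (t ℕ.≟ a)) {b} {L} b≢a =
    trans (cong (+ b *_) (proj₁ IH)) (swap (+ b) (+ a) (∏ (L without a))) , cong suc (proj₂ IH)
    where
    IH = ∏-without L u a∈L
    swap : ∀ x y z → x * (y * z) ≡ y * (x * z)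
    swap = solve-∀

  record PairedBy (τ : ℕ → ℕ) (c : ℤ) (L : List ℕ) : Set where
    field
      closed        : ∀ {t} → t ∈ L → τ t ∈ L
      involutive    : ∀ {t} → t ∈ L → τ (τ t) ≡ t
      fixpoint-free : ∀ {t} → t ∈ L → τ t ≢ t
      pair-product  : ∀ {t} → t ∈ L → + t * + τ t ≈ c

  private
    paired-rest : ∀ {τ c t L} → Unique (t ∷ L) → PairedBy τ c (t ∷ L) → τ t ∈ L → PairedBy τ c (L without τ t)
    paired-rest {τ} {c} {t} {L} (t∉L ∷ _) paired τt∈L = record
      { closed = closed′
      ; involutive = λ v∈L′ → involutive (there (in-L v∈L′))
      ; fixpoint-free = λ v∈L′ → fixpoint-free (there (in-L v∈L′))
      ; pair-product = λ v∈L′ → pair-product (there (in-L v∈L′))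
      }
      where
      open PairedBy paired
      in-L : ∀ {v} → v ∈ L without τ t → v ∈ L
      in-L v∈L′ = proj₁ (∈-without⁻ L v∈L′)
      closed′ : ∀ {v} → v ∈ L without τ t → τ v ∈ L without τ t
      closed′ {v} v∈L′ with closed (there (in-L v∈L′))
      ... | here τv≡t = ⊥-elim (proj₂ (∈-without⁻ L v∈L′) (trans (sym (involutive (there (in-L v∈L′)))) (cong τ τv≡t)))
      ... | there τv∈L = ∈-without⁺ L τv∈L τv≢τt
        where
        τv≢τt : τ v ≢ τ t
        τv≢τt τv≡τt = All.lookup t∉L (in-L v∈L′)
          (sym (trans (sym (involutive (there (in-L v∈L′)))) (trans (cong τ τv≡τt) (involutive (here refl)))))

    ∏-paired-bounded : ∀ {τ c} fuel L → length L ℕ.≤ fuel → Unique L → PairedBy τ c L →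
                       ∃ λ k → length L ≡ k ℕ.+ k × ∏ L ≈ c ^ k
    ∏-paired-bounded fuel [] _ _ _ = 0 , refl , ≈-refl
    ∏-paired-bounded {τ} {c} (suc fuel) (t ∷ L) (ℕ.s≤s len≤) u@(_ ∷ uL) paired =
      suc k , length-eq , product-eq
      where
      open PairedBy paired
      τt∈L : τ t ∈ L
      τt∈L with closed (here refl)
      ... | here τt≡t = ⊥-elim (fixpoint-free (here refl) τt≡t)
      ... | there τt∈L = τt∈L
      L′ = L without τ t
      split = ∏-without L uL τt∈L
      IH = ∏-paired-bounded fuel L′
             (ℕ.≤-trans (ℕ.n≤1+n _) (subst (ℕ._≤ fuel) (proj₂ split) len≤))
             (without-unique L uL) (paired-rest u paired τt∈L)
      k = proj₁ IH
      length-eq : suc (length L) ≡ suc k ℕ.+ suc k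
      length-eq = cong suc (trans (proj₂ split) (trans (cong suc (proj₁ (proj₂ IH))) (sym (ℕ.+-suc k k))))
      product-eq : + t * ∏ L ≈ c * c ^ k
      product-eq = begin
        + t * ∏ L                ≡⟨ cong (+ t *_) (proj₁ split) ⟩
        + t * (+ τ t * ∏ L′)     ≡⟨ assoc (+ t) (+ τ t) (∏ L′) ⟩
        (+ t * + τ t) * ∏ L′     ≈⟨ *-cong (pair-product (here refl)) (proj₂ (proj₂ IH)) ⟩
        c * c ^ k                ∎
        where
        assoc : ∀ x y z → x * (y * z) ≡ (x * y) * z
        assoc = solve-∀

  ∏-paired : ∀ {τ c} L → Unique L → PairedBy τ c L → ∃ λ k → length L ≡ k ℕ.+ k × ∏ L ≈ c ^ k
  ∏-paired L = ∏-paired-bounded (length L) L ℕ.≤-refl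

module PrimeModulus (p : ℕ) (p-prime : Prime p) where

  open import Data.Nat as ℕ using (ℕ; zero; suc; NonZero)
  import Data.Nat.Properties as ℕ
  import Data.Nat.Divisibility as ℕ
  open import Data.Nat.GCD using (module Bézout; module GCD)
  import Data.Nat.Coprimality as Coprimality
  open import Data.Nat.Primality using (euclidsLemma; prime⇒nonZero; prime⇒nonTrivial)
  open import Data.Integer using (ℤ; +_; -_; _+_; _-_; _*_; _^_; 0ℤ; 1ℤ; ∣_∣)
  import Data.Integer.Properties as ℤ
  open import Data.Integer.DivMod using (_%ℕ_; _/ℕ_; n%ℕd<d; a≡a%ℕn+[a/ℕn]*n)
  open import Data.Integer.Divisibility.Signed using (_∣_; ∣ᵤ⇒∣; ∣⇒∣ᵤ; ∣-refl; ∣n⇒∣m*n)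
  open import Data.Integer.Tactic.RingSolver using (solve-∀)
  open import Data.Sum as Sum using (_⊎_; [_,_]′)
  open import Function using (_∘_)
  open import Data.Empty using (⊥-elim)
  open import Relation.Nullary using (yes; no)
  open import Relation.Binary.PropositionalEquality using (_≡_; sym; trans; cong; subst; module ≡-Reasoning)
  open Congruence p

  private instance
    p-nonZero : NonZero p
    p-nonZero = prime⇒nonZero p-prime

  1<p : 1 ℕ.< p
  1<p = ℕ.nonTrivial⇒n>1 p {{prime⇒nonTrivial p-prime}}

  ≈0-euclid : ∀ x y → x * y ≈ 0ℤ → x ≈ 0ℤ ⊎ y ≈ 0ℤ
  ≈0-euclid x y xy≈0 = Sum.map (∣⇒≈0 ∘ ∣ᵤ⇒∣) (∣⇒≈0 ∘ ∣ᵤ⇒∣)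
    (euclidsLemma ∣ x ∣ ∣ y ∣ p-prime (subst (p ℕ.∣_) (ℤ.abs-* x y) (∣⇒∣ᵤ (≈0⇒∣ xy≈0))))

  ≉0-* : ∀ {x y} → x ≉ 0ℤ → y ≉ 0ℤ → x * y ≉ 0ℤ
  ≉0-* {x} {y} x≉0 y≉0 xy≈0 = [ x≉0 , y≉0 ]′ (≈0-euclid x y xy≈0)

  <p-injective : ∀ {a b} → a ℕ.< p → b ℕ.< p → + a ≈ + b → a ≡ b
  <p-injective {a} {b} a<p b<p a≈b with ∣ + a - + b ∣ ℕ.≟ 0
  ... | yes ∣a-b∣≡0 = ℤ.+-injective (ℤ.i-j≡0⇒i≡j (+ a) (+ b) (ℤ.∣i∣≡0⇒i≡0 ∣a-b∣≡0))
  ... | no ∣a-b∣≢0 = ⊥-elim (ℕ.<⇒≱ ∣a-b∣<p (ℕ.∣⇒≤ {{ℕ.≢-nonZero ∣a-b∣≢0}} (∣⇒∣ᵤ (∣-diff a≈b))))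
    where
    ∣a-b∣<p : ∣ + a - + b ∣ ℕ.< p
    ∣a-b∣<p = ℕ.≤-<-trans (subst (ℕ._≤ a ℕ.⊔ b) (cong ∣_∣ (sym (ℤ.[+m]-[+n]≡m⊖n a b))) (ℤ.∣m⊝n∣≤m⊔n a b))
                         (ℕ.⊔-lub a<p b<p)

  <p-≉0 : ∀ {t} → 1 ℕ.≤ t → t ℕ.< p → + t ≉ 0ℤ
  <p-≉0 {suc t} _ t<p t≈0 with <p-injective t<p (ℕ.<-trans (ℕ.s≤s ℕ.z≤n) t<p) t≈0
  ... | ()

  ≉0-^ : ∀ {x} k → x ≉ 0ℤ → x ^ k ≉ 0ℤ
  ≉0-^ zero x≉0 = <p-≉0 (ℕ.s≤s ℕ.z≤n) 1<p
  ≉0-^ (suc k) x≉0 = ≉0-* x≉0 (≉0-^ k x≉0)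

  opaque
    residue : ℤ → ℕ
    residue z = z %ℕ p

    residue<p : ∀ z → residue z ℕ.< p
    residue<p z = n%ℕd<d z p

    residue≈ : ∀ z → + residue z ≈ z
    residue≈ z = ≈-sym (mk≈ (subst (+ p ∣_) (sym division) (∣n⇒∣m*n (z /ℕ p) ∣-refl)))
      where
      cancel : ∀ r q → (r + q) - r ≡ q
      cancel = solve-∀
      division : z - + residue z ≡ (z /ℕ p) * + p
      division = trans (cong (_- + residue z) (a≡a%ℕn+[a/ℕn]*n z p)) (cancel (+ residue z) ((z /ℕ p) * + p))

  residue-≥1 : ∀ {x} → x ≉ 0ℤ → 1 ℕ.≤ residue x
  residue-≥1 {x} x≉0 with residue x in eq
  ... | zero = ⊥-elim (x≉0 (≈-trans (≈-sym (residue≈ x)) (≡⇒≈ (cong (λ z → + z) eq))))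
  ... | suc _ = ℕ.s≤s ℕ.z≤n

  private
    gcd≡1 : ∀ {t d} → 1 ℕ.≤ t → t ℕ.< p → GCD.GCD t p d → d ≡ 1
    gcd≡1 {suc _} _ t<p g =
      GCD.unique g (Coprimality.coprime⇒GCD≡1 (Coprimality.sym (Coprimality.prime⇒coprime p-prime t<p)))

    1+bc-in-ℤ : ∀ {b c e} → 1 ℕ.+ b ℕ.* c ≡ e → 1ℤ + + b * + c ≡ + e
    1+bc-in-ℤ {b} {c} eq = trans (cong (λ z → 1ℤ + z) (sym (ℤ.pos-* b c))) (cong (λ z → + z) eq)

  opaque
    inverse : ℕ → ℤ
    inverse t with Bézout.lemma t p
    ... | Bézout.result _ _ (Bézout.+- x _ _) = + x
    ... | Bézout.result _ _ (Bézout.-+ x _ _) = - + x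

    *-inverse : ∀ {t} → 1 ℕ.≤ t → t ℕ.< p → + t * inverse t ≈ 1ℤ
    *-inverse {t@(suc _)} _ t<p with Bézout.lemma t p
    ... | Bézout.result d g (Bézout.+- x y eq) = mk≈ (subst (+ p ∣_) (sym bézout) (∣n⇒∣m*n (+ y) ∣-refl))
      where
      bézout : + t * + x - 1ℤ ≡ + y * + p
      bézout = begin
        + t * + x - 1ℤ           ≡⟨ cong (_- 1ℤ) (trans (ℤ.pos-* x t) (ℤ.*-comm (+ x) (+ t))) ⟨
        + (x ℕ.* t) - 1ℤ         ≡⟨ cong (_- 1ℤ) (1+bc-in-ℤ {y} {p} (trans (cong (ℕ._+ y ℕ.* p) (sym (gcd≡1 (ℕ.s≤s ℕ.z≤n) t<p g))) eq)) ⟨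
        1ℤ + + y * + p - 1ℤ      ≡⟨ cancel (+ y * + p) ⟩
        + y * + p                ∎
        where
        open ≡-Reasoning
        cancel : ∀ a → 1ℤ + a - 1ℤ ≡ a
        cancel = solve-∀
    ... | Bézout.result d g (Bézout.-+ x y eq) = mk≈ (subst (+ p ∣_) (sym bézout) (∣n⇒∣m*n (- + y) ∣-refl))
      where
      bézout : + t * - + x - 1ℤ ≡ - + y * + p
      bézout = begin
        + t * - + x - 1ℤ         ≡⟨ negate (+ t) (+ x) ⟩
        - (1ℤ + + x * + t)       ≡⟨ cong -_ (1+bc-in-ℤ {x} {t} (trans (cong (ℕ._+ x ℕ.* t) (sym (gcd≡1 (ℕ.s≤s ℕ.z≤n) t<p g))) eq)) ⟩
        - + (y ℕ.* p)            ≡⟨ cong -_ (ℤ.pos-* y p) ⟩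
        - (+ y * + p)            ≡⟨ ℤ.neg-distribˡ-* (+ y) (+ p) ⟩
        - + y * + p              ∎
        where
        open ≡-Reasoning
        negate : ∀ t x → t * - x - 1ℤ ≡ - (1ℤ + x * t)
        negate = solve-∀

  _⁻¹ : ℤ → ℤ
  x ⁻¹ = inverse (residue x)

  *-inverseʳ : ∀ {x} → x ≉ 0ℤ → x * x ⁻¹ ≈ 1ℤ
  *-inverseʳ {x} x≉0 = ≈-trans (*-congʳ (x ⁻¹) (≈-sym (residue≈ x))) (*-inverse (residue-≥1 x≉0) (residue<p x))

  *-cancelˡ : ∀ {c x y} → c ≉ 0ℤ → c * x ≈ c * y → x ≈ y
  *-cancelˡ {c} {x} {y} c≉0 cx≈cy = begin
    x                  ≡⟨ ℤ.*-identityˡ x ⟨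
    1ℤ * x             ≈⟨ *-congʳ x (*-inverseʳ c≉0) ⟨
    (c * c ⁻¹) * x     ≡⟨ rotate c (c ⁻¹) x ⟩
    c ⁻¹ * (c * x)     ≈⟨ *-congˡ (c ⁻¹) cx≈cy ⟩
    c ⁻¹ * (c * y)     ≡⟨ rotate c (c ⁻¹) y ⟨
    (c * c ⁻¹) * y     ≈⟨ *-congʳ y (*-inverseʳ c≉0) ⟩
    1ℤ * y             ≡⟨ ℤ.*-identityˡ y ⟩
    y                  ∎
    where
    open ≈-Reasoning
    rotate : ∀ a b z → (a * b) * z ≡ b * (a * z)
    rotate = solve-∀

  ⁻¹-unique : ∀ {x y} → x ≉ 0ℤ → x * y ≈ 1ℤ → x ⁻¹ ≈ y
  ⁻¹-unique x≉0 xy≈1 = *-cancelˡ x≉0 (≈-trans (*-inverseʳ x≉0) (≈-sym xy≈1))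

  ≈-square-roots : ∀ x y → x * x ≈ y * y → x ≈ y ⊎ x ≈ - y
  ≈-square-roots x y xx≈yy =
    Sum.map -≈0⇒≈ (λ x+y≈0 → -≈0⇒≈ (≈-trans (≡⇒≈ (cong (λ z → x + z) (ℤ.neg-involutive y))) x+y≈0))
            (≈0-euclid (x - y) (x + y) (≈-trans (≡⇒≈ (difference-of-squares x y)) (≈⇒-≈0 xx≈yy)))
    where
    difference-of-squares : ∀ x y → (x - y) * (x + y) ≡ x * x - y * y
    difference-of-squares = solve-∀

module QuadraticResidues (n : ℕ) (p-prime : Prime (ℕ.suc (n ℕ.+ n))) where

  open import Data.Nat as ℕ using (ℕ; zero; suc)
  import Data.Nat.Properties as ℕ
  open import Data.Integer using (ℤ; +_; -_; _+_; _-_; _*_; _^_; 0ℤ; 1ℤ; ∣_∣)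
  import Data.Integer.Properties as ℤ
  open import Data.Integer.Tactic.RingSolver using (solve-∀)
  open import Data.Product using (_×_; _,_; ∃; proj₁; proj₂)
  open import Data.Sum as Sum using (_⊎_; [_,_]′)
  open import Data.List using (List; length; applyUpTo)
  open import Data.List.Properties using (length-applyUpTo)
  open import Data.List.Relation.Unary.Unique.Propositional using (Unique)
  open import Data.List.Relation.Unary.Unique.Propositional.Properties using (applyUpTo⁺₁)
  open import Data.List.Membership.Propositional using (_∈_)
  open import Data.List.Membership.Propositional.Properties using (∈-applyUpTo⁺; ∈-applyUpTo⁻)
  open import Relation.Nullary using (yes; no)
  import Data.Nat.Divisibility as ℕ
  open import Data.Integer.Divisibility.Signed using (∣ᵤ⇒∣; ∣⇒∣ᵤ)
  open import Data.Fin using (Fin; toℕ; fromℕ<)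
  open import Data.Fin.Properties using (any?; toℕ-fromℕ<)
  open import Defs using (legendre)
  open import Function using (_∘_)
  open import Relation.Binary.PropositionalEquality using (_≡_; _≢_; refl; sym; trans; cong; subst)

  p : ℕ
  p = suc (n ℕ.+ n)

  open Congruence p
  open PrimeModulus p p-prime
  open InvolutionProducts p

  units : List ℕ
  units = applyUpTo suc (n ℕ.+ n)

  ∈-units⁻ : ∀ {t} → t ∈ units → 1 ℕ.≤ t × t ℕ.< p
  ∈-units⁻ t∈ with ∈-applyUpTo⁻ suc t∈
  ... | i , i<2n , refl = ℕ.s≤s ℕ.z≤n , ℕ.s≤s i<2n

  ∈-units⁺ : ∀ {t} → 1 ℕ.≤ t → t ℕ.< p → t ∈ units
  ∈-units⁺ {suc t} _ (ℕ.s≤s t<2n) = ∈-applyUpTo⁺ suc t<2n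

  units-unique : Unique units
  units-unique = applyUpTo⁺₁ suc (n ℕ.+ n) (λ i<j _ i≡j → ℕ.<⇒≢ i<j (ℕ.suc-injective i≡j))

  private
    +-double-injective : ∀ a b → a ℕ.+ a ≡ b ℕ.+ b → a ≡ b
    +-double-injective a b eq = ℕ.*-cancelˡ-≡ a b 2 (trans (cong (a ℕ.+_) (ℕ.+-identityʳ a))
                                                   (trans eq (sym (cong (b ℕ.+_) (ℕ.+-identityʳ b)))))

    ∏-units-half : ∀ (f : ℕ → ℤ) → (∃ λ k → length units ≡ k ℕ.+ k × ∏ units ≈ f k) → ∏ units ≈ f n
    ∏-units-half f (k , len , ∏≈) =
      subst (λ e → ∏ units ≈ f e) (sym (+-double-injective n k (trans (sym (length-applyUpTo suc _)) len))) ∏≈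

  module Partner (g : ℤ) (g≉0 : g ≉ 0ℤ) where

    partner : ℕ → ℕ
    partner t = residue (g * inverse t)

    module _ {t} (1≤t : 1 ℕ.≤ t) (t<p : t ℕ.< p) where

      partner-bounds : 1 ℕ.≤ partner t × partner t ℕ.< p
      partner-bounds = residue-≥1 (≉0-* g≉0 inverse≉0) , residue<p (g * inverse t)
        where
        inverse≉0 : inverse t ≉ 0ℤ
        inverse≉0 inv≈0 = <p-≉0 (ℕ.s≤s ℕ.z≤n) 1<p
          (≈-trans (≈-sym (*-inverse 1≤t t<p)) (≈-trans (*-congˡ (+ t) inv≈0) (≡⇒≈ (ℤ.*-zeroʳ (+ t)))))

      *-partner : + t * + partner t ≈ g
      *-partner = begin
        + t * + partner t       ≈⟨ *-congˡ (+ t) (residue≈ (g * inverse t)) ⟩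
        + t * (g * inverse t)   ≡⟨ swap (+ t) g (inverse t) ⟩
        g * (+ t * inverse t)   ≈⟨ *-congˡ g (*-inverse 1≤t t<p) ⟩
        g * 1ℤ                  ≡⟨ ℤ.*-identityʳ g ⟩
        g                       ∎
        where
        open ≈-Reasoning
        swap : ∀ a b c → a * (b * c) ≡ b * (a * c)
        swap = solve-∀

      partner-unique : ∀ {s} → s ℕ.< p → + t * + s ≈ g → s ≡ partner t
      partner-unique s<p ts≈g =
        <p-injective s<p (residue<p (g * inverse t)) (*-cancelˡ (<p-≉0 1≤t t<p) (≈-trans ts≈g (≈-sym *-partner)))

    partner-involutive : ∀ {t} → 1 ℕ.≤ t → t ℕ.< p → partner (partner t) ≡ t
    partner-involutive {t} 1≤t t<p = sym (partner-unique 1≤s s<p t<p (≈-trans (≡⇒≈ (ℤ.*-comm (+ s) (+ t))) (*-partner 1≤t t<p)))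
      where
      s = partner t
      1≤s = proj₁ (partner-bounds 1≤t t<p)
      s<p = proj₂ (partner-bounds 1≤t t<p)

    partner-pairs : ∀ {L} → (∀ {t} → t ∈ L → 1 ℕ.≤ t × t ℕ.< p) → (∀ {t} → t ∈ L → partner t ∈ L) →
                    (∀ {t} → t ∈ L → + t * + t ≉ g) → PairedBy partner g L
    partner-pairs bounded closed nonroot = record
      { closed = closed
      ; involutive = λ t∈L → partner-involutive (proj₁ (bounded t∈L)) (proj₂ (bounded t∈L))
      ; fixpoint-free = λ {t} t∈L t≡partner → nonroot t∈L
          (subst (λ s → + t * + s ≈ g) t≡partner (*-partner (proj₁ (bounded t∈L)) (proj₂ (bounded t∈L))))
      ; pair-product = λ t∈L → *-partner (proj₁ (bounded t∈L)) (proj₂ (bounded t∈L))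
      }

    partner∈units : ∀ {t} → t ∈ units → partner t ∈ units
    partner∈units t∈ = ∈-units⁺ (proj₁ bounds) (proj₂ bounds)
      where bounds = partner-bounds (proj₁ (∈-units⁻ t∈)) (proj₂ (∈-units⁻ t∈))

    ∏-units-nonresidue : (∀ y → y * y ≉ g) → ∏ units ≈ g ^ n
    ∏-units-nonresidue nonresidue =
      ∏-units-half (g ^_) (∏-paired units units-unique (partner-pairs ∈-units⁻ partner∈units (λ {t} _ → nonresidue (+ t))))

    -- The square roots r and p − r of g are the only self-paired units; together they contribute r(p − r) ≡ −g.
    module SquareRoot (y : ℤ) (yy≈g : y * y ≈ g) where

      r q : ℕ
      r = residue y
      q = p ℕ.∸ r

      r<p : r ℕ.< p
      r<p = residue<p y

      1≤r : 1 ℕ.≤ r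
      1≤r = residue-≥1 (λ y≈0 → g≉0 (≈-trans (≈-sym yy≈g) (*-congʳ y y≈0)))

      1≤q : 1 ℕ.≤ q
      1≤q = ℕ.m<n⇒0<n∸m r<p

      q<p : q ℕ.< p
      q<p = ℕ.∸-monoʳ-< 1≤r (ℕ.<⇒≤ r<p)

      q≈-r : + q ≈ - + r
      q≈-r = ≈-trans (≡⇒≈ (sym (trans (ℤ.[+m]-[+n]≡m⊖n p r) (ℤ.⊖-≥ (ℕ.<⇒≤ r<p)))))
               (≈-trans (-‿cong p≈0 (≈-refl {+ r})) (≡⇒≈ (ℤ.+-identityˡ (- + r))))

      q≢r : q ≢ r
      q≢r q≡r = ℕ.even≢odd r n (trans (double r) (trans (cong (ℕ._+ r) (sym q≡r))
                  (trans (ℕ.m∸n+n≡m (ℕ.<⇒≤ r<p)) (cong suc (sym (double n))))))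
        where
        double : ∀ m → 2 ℕ.* m ≡ m ℕ.+ m
        double m = cong (m ℕ.+_) (ℕ.+-identityʳ m)

      rr≈g : + r * + r ≈ g
      rr≈g = ≈-trans (*-cong (residue≈ y) (residue≈ y)) yy≈g

      qq≈g : + q * + q ≈ g
      qq≈g = ≈-trans (*-cong q≈-r q≈-r) (≈-trans (≡⇒≈ (neg-square (+ r))) rr≈g)
        where
        neg-square : ∀ a → - a * - a ≡ a * a
        neg-square = solve-∀

      roots : ∀ {t} → t ℕ.< p → + t * + t ≈ g → t ≡ r ⊎ t ≡ q
      roots t<p tt≈g = Sum.map (<p-injective t<p r<p) (λ t≈-r → <p-injective t<p q<p (≈-trans t≈-r (≈-sym q≈-r)))
                               (≈-square-roots _ (+ r) (≈-trans tt≈g (≈-sym rr≈g)))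

      partner-root : ∀ {t s} → t ∈ units → 1 ℕ.≤ s → s ℕ.< p → + s * + s ≈ g → partner t ≡ s → t ≡ s
      partner-root {t} {s} t∈ 1≤s s<p ss≈g partner≡s = <p-injective (proj₂ (∈-units⁻ t∈)) s<p
        (*-cancelˡ (<p-≉0 1≤s s<p) (≈-trans (≡⇒≈ (ℤ.*-comm (+ s) (+ t)))
          (≈-trans (subst (λ z → + t * + z ≈ g) partner≡s (*-partner (proj₁ (∈-units⁻ t∈)) (proj₂ (∈-units⁻ t∈))))
                   (≈-sym ss≈g))))

      nonroots : List ℕ
      nonroots = (units without r) without q

      ∈-nonroots⁻ : ∀ {t} → t ∈ nonroots → t ∈ units × t ≢ r × t ≢ q
      ∈-nonroots⁻ t∈ = let (t∈′ , t≢q) = ∈-without⁻ (units without r) t∈ ; (t∈units , t≢r) = ∈-without⁻ units t∈′ in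
                       t∈units , t≢r , t≢q

      nonroots-paired : PairedBy partner g nonroots
      nonroots-paired = partner-pairs bounded closed nonroot
        where
        bounded : ∀ {t} → t ∈ nonroots → 1 ℕ.≤ t × t ℕ.< p
        bounded = ∈-units⁻ ∘ proj₁ ∘ ∈-nonroots⁻
        closed : ∀ {t} → t ∈ nonroots → partner t ∈ nonroots
        closed t∈ = let (t∈units , t≢r , t≢q) = ∈-nonroots⁻ t∈ in
          ∈-without⁺ (units without r) (∈-without⁺ units (partner∈units t∈units) (t≢r ∘ partner-root t∈units 1≤r r<p rr≈g))
                     (t≢q ∘ partner-root t∈units 1≤q q<p qq≈g)
        nonroot : ∀ {t} → t ∈ nonroots → + t * + t ≉ g
        nonroot t∈ tt≈g = let (t∈units , t≢r , t≢q) = ∈-nonroots⁻ t∈ in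
          [ t≢r , t≢q ]′ (roots (proj₂ (∈-units⁻ t∈units)) tt≈g)

      ∏-units-residue : ∏ units ≈ - g ^ n
      ∏-units-residue = ∏-units-half (λ e → - g ^ e) (suc k , length-eq , product-eq)
        where
        paired = ∏-paired nonroots (without-unique _ (without-unique units units-unique)) nonroots-paired
        k = proj₁ paired
        split-r = ∏-without units units-unique (∈-units⁺ 1≤r r<p)
        split-q = ∏-without (units without r) (without-unique units units-unique) (∈-without⁺ units (∈-units⁺ 1≤q q<p) q≢r)
        length-eq : length units ≡ suc k ℕ.+ suc k
        length-eq = trans (proj₂ split-r) (trans (cong suc (proj₂ split-q))
                      (trans (cong (λ z → suc (suc z)) (proj₁ (proj₂ paired))) (cong suc (sym (ℕ.+-suc k k)))))
        product-eq : ∏ units ≈ - g ^ suc k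
        product-eq = begin
          ∏ units                         ≡⟨ proj₁ split-r ⟩
          + r * ∏ (units without r)       ≡⟨ cong (+ r *_) (proj₁ split-q) ⟩
          + r * (+ q * ∏ nonroots)        ≈⟨ *-congˡ (+ r) (*-cong q≈-r (proj₂ (proj₂ paired))) ⟩
          + r * (- + r * g ^ k)           ≡⟨ regroup (+ r) (g ^ k) ⟩
          - ((+ r * + r) * g ^ k)         ≈⟨ neg-cong (*-congʳ (g ^ k) rr≈g) ⟩
          - (g * g ^ k)                   ∎
          where
          open ≈-Reasoning
          regroup : ∀ a b → a * (- a * b) ≡ - ((a * a) * b)
          regroup = solve-∀

  1≤n : 1 ℕ.≤ n
  1≤n = positive-half 1<p
    where
    positive-half : ∀ {m} → 1 ℕ.< suc (m ℕ.+ m) → 1 ℕ.≤ m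
    positive-half {zero} (ℕ.s≤s ())
    positive-half {suc m} _ = ℕ.s≤s ℕ.z≤n

  2<p : 2 ℕ.< p
  2<p = ℕ.s≤s (ℕ.+-mono-≤ 1≤n 1≤n)

  private
    1≉0 : 1ℤ ≉ 0ℤ
    1≉0 = <p-≉0 (ℕ.s≤s ℕ.z≤n) 1<p

  wilson : ∏ units ≈ - 1ℤ
  wilson = ≈-trans (Partner.SquareRoot.∏-units-residue 1ℤ 1≉0 1ℤ ≈-refl) (≡⇒≈ (cong -_ (ℤ.^-zeroˡ n)))

  square-^-half : ∀ {t} → t ≉ 0ℤ → (t * t) ^ n ≈ 1ℤ
  square-^-half {t} t≉0 = neg-injective (≈-trans (≈-sym (Partner.SquareRoot.∏-units-residue (t * t) (≉0-* t≉0 t≉0) t ≈-refl)) wilson)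

  euler-criterion : ∀ c → c ^ n ≈ legendre c p
  euler-criterion c with p ℕ.∣? ∣ c ∣
  ... | yes p∣c = ^-≈0 n 1≤n (∣ᵤ⇒≈0 p∣c)
  ... | no p∤c with any? {n = p} (λ (y : Fin p) → p ℕ.∣? ∣ (+ toℕ y) * (+ toℕ y) - c ∣)
  ...   | yes (y , p∣yy-c) = neg-injective (≈-trans (≈-sym (Partner.SquareRoot.∏-units-residue c (∤ᵤ⇒≉0 p∤c) (+ toℕ y) (mk≈ (∣ᵤ⇒∣ p∣yy-c)))) wilson)
  ...   | no nonresidue = ≈-trans (≈-sym (Partner.∏-units-nonresidue c (∤ᵤ⇒≉0 p∤c) nonresidue′)) wilson
    where
    nonresidue′ : ∀ y → y * y ≉ c
    nonresidue′ y yy≈c = nonresidue (fromℕ< (residue<p y) ,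
      ∣⇒∣ᵤ (∣-diff (subst (λ z → + z * + z ≈ c) (sym (toℕ-fromℕ< (residue<p y))) (≈-trans (*-cong (residue≈ y) (residue≈ y)) yy≈c))))

  fermat : ∀ t → t ^ p ≈ t
  fermat t with ≈0? t
  ... | yes t≈0 = ≈-trans (^-≈0 p (ℕ.s≤s ℕ.z≤n) t≈0) (≈-sym t≈0)
  ... | no t≉0 = begin
    t * t ^ (n ℕ.+ n)    ≡⟨ cong (t *_) (trans (ℤ.^-distribˡ-+-* t n n) (sym (^-distrib-* t t n))) ⟩
    t * (t * t) ^ n      ≈⟨ *-congˡ t (square-^-half t≉0) ⟩
    t * 1ℤ               ≡⟨ ℤ.*-identityʳ t ⟩
    t                    ∎
    where open ≈-Reasoning

-- The prime is given as suc p-1 so that Pascal's rule applies at index p.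
module Lucas (p-1 : ℕ) (p-prime : Prime (ℕ.suc p-1)) where

  open import Data.Nat as ℕ using (ℕ; zero; suc)
  import Data.Nat.Properties as ℕ
  open import Data.Nat.Combinatorics using (_C_; k>n⇒nCk≡0; nCn≡1)
  import Data.Nat.Tactic.RingSolver as ℕ-Solver
  open import Data.Integer using (ℤ; +_; _+_; _*_; 0ℤ; 1ℤ)
  import Data.Integer.Properties as ℤ
  open import Data.Integer.Tactic.RingSolver using (solve-∀)
  open import Data.Empty using (⊥-elim)
  open import Data.Sum using ([_,_]′)
  open import Function using (_∘_; id)
  open import Relation.Binary.PropositionalEquality using (_≡_; sym; trans; cong; cong₂)
  open Binomial using (pascal; [k+1]*[m+1]C[k+1]≡[m+1]*mCk)

  p : ℕ
  p = suc p-1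

  open Congruence p
  open PrimeModulus p p-prime
  open ≈-Reasoning

  infix 10 _Cℤ_
  _Cℤ_ : ℕ → ℕ → ℤ
  m Cℤ k = + (m C k)

  pascalℤ : ∀ m k → suc m Cℤ suc k ≡ m Cℤ k + m Cℤ suc k
  pascalℤ m k = trans (cong +_ (pascal m k)) (ℤ.pos-+ (m C k) (m C suc k))

  Cℤ-zero : ∀ {m k} → m ℕ.< k → m Cℤ k ≡ 0ℤ
  Cℤ-zero k>m = cong +_ (k>n⇒nCk≡0 k>m)

  pCt≈0 : ∀ t → 1 ℕ.≤ t → t ℕ.< p → p Cℤ t ≈ 0ℤ
  pCt≈0 (suc t) _ t<p = [ ⊥-elim ∘ <p-≉0 (ℕ.s≤s ℕ.z≤n) t<p , id ]′ (≈0-euclid (+ suc t) (p Cℤ suc t) absorption)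
    where
    absorption : + suc t * p Cℤ suc t ≈ 0ℤ
    absorption = begin
      + suc t * p Cℤ suc t      ≡⟨ ℤ.pos-* (suc t) (p C suc t) ⟨
      + (suc t ℕ.* (p C suc t)) ≡⟨ cong +_ ([k+1]*[m+1]C[k+1]≡[m+1]*mCk p-1 t) ⟩
      + (p ℕ.* (p-1 C t))       ≡⟨ ℤ.pos-* p (p-1 C t) ⟩
      + p * p-1 Cℤ t            ≈⟨ *-congʳ (p-1 Cℤ t) p≈0 ⟩
      0ℤ * p-1 Cℤ t             ≡⟨ ℤ.*-zeroˡ (p-1 Cℤ t) ⟩
      0ℤ                        ∎

  [m+p]Ct≈mCt : ∀ m t → t ℕ.< p → (m ℕ.+ p) Cℤ t ≈ m Cℤ t
  [m+p]Ct≈mCt zero zero _ = ≈-refl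
  [m+p]Ct≈mCt zero (suc t) t<p = pCt≈0 (suc t) (ℕ.s≤s ℕ.z≤n) t<p
  [m+p]Ct≈mCt (suc m) zero _ = ≈-refl
  [m+p]Ct≈mCt (suc m) (suc t) t<p = begin
    suc (m ℕ.+ p) Cℤ suc t                  ≡⟨ pascalℤ (m ℕ.+ p) t ⟩
    (m ℕ.+ p) Cℤ t + (m ℕ.+ p) Cℤ suc t     ≈⟨ +-cong ([m+p]Ct≈mCt m t (ℕ.<-trans (ℕ.n<1+n t) t<p)) ([m+p]Ct≈mCt m (suc t) t<p) ⟩
    m Cℤ t + m Cℤ suc t                     ≡⟨ pascalℤ m t ⟨
    suc m Cℤ suc t                          ∎

  [m+p]C[t+p]≈mC[t+p]+mCt : ∀ m t → (m ℕ.+ p) Cℤ (t ℕ.+ p) ≈ m Cℤ (t ℕ.+ p) + m Cℤ t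
  [m+p]C[t+p]≈mC[t+p]+mCt zero zero = ≡⇒≈ (trans (cong +_ (nCn≡1 p)) (cong (_+ 1ℤ) (sym (Cℤ-zero {0} {p} (ℕ.s≤s ℕ.z≤n)))))
  [m+p]C[t+p]≈mC[t+p]+mCt zero (suc t) =
    ≡⇒≈ (trans (Cℤ-zero {p} {suc t ℕ.+ p} (ℕ.m<n+m p (ℕ.s≤s ℕ.z≤n))) (sym (ℤ.+-identityʳ _)))
  [m+p]C[t+p]≈mC[t+p]+mCt (suc m) zero = begin
    suc (m ℕ.+ p) Cℤ p                            ≡⟨ pascalℤ (m ℕ.+ p) p-1 ⟩
    (m ℕ.+ p) Cℤ p-1 + (m ℕ.+ p) Cℤ p             ≈⟨ +-cong ([m+p]Ct≈mCt m p-1 (ℕ.n<1+n p-1)) ([m+p]C[t+p]≈mC[t+p]+mCt m zero) ⟩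
    m Cℤ p-1 + (m Cℤ p + m Cℤ 0)                  ≡⟨ ℤ.+-assoc (m Cℤ p-1) (m Cℤ p) (m Cℤ 0) ⟨
    (m Cℤ p-1 + m Cℤ p) + m Cℤ 0                  ≡⟨ cong (_+ m Cℤ 0) (pascalℤ m p-1) ⟨
    suc m Cℤ p + suc m Cℤ 0                       ∎
  [m+p]C[t+p]≈mC[t+p]+mCt (suc m) (suc t) = begin
    suc (m ℕ.+ p) Cℤ suc (t ℕ.+ p)                          ≡⟨ pascalℤ (m ℕ.+ p) (t ℕ.+ p) ⟩
    (m ℕ.+ p) Cℤ (t ℕ.+ p) + (m ℕ.+ p) Cℤ (suc t ℕ.+ p)     ≈⟨ +-cong ([m+p]C[t+p]≈mC[t+p]+mCt m t) ([m+p]C[t+p]≈mC[t+p]+mCt m (suc t)) ⟩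
    (m Cℤ (t ℕ.+ p) + m Cℤ t) + (m Cℤ (suc t ℕ.+ p) + m Cℤ suc t)
      ≡⟨ interchange (m Cℤ (t ℕ.+ p)) (m Cℤ t) (m Cℤ (suc t ℕ.+ p)) (m Cℤ suc t) ⟩
    (m Cℤ (t ℕ.+ p) + m Cℤ (suc t ℕ.+ p)) + (m Cℤ t + m Cℤ suc t) ≡⟨ cong₂ _+_ (pascalℤ m (t ℕ.+ p)) (pascalℤ m t) ⟨
    suc m Cℤ (suc t ℕ.+ p) + suc m Cℤ suc t                  ∎
    where
    interchange : ∀ a b c d → (a + b) + (c + d) ≡ (a + c) + (b + d)
    interchange = solve-∀

  private
    shift : ∀ M p r → suc M ℕ.* p ℕ.+ r ≡ (M ℕ.* p ℕ.+ r) ℕ.+ p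
    shift = ℕ-Solver.solve-∀

  lucas : ∀ M K r s → r ℕ.< p → s ℕ.< p → (M ℕ.* p ℕ.+ r) Cℤ (K ℕ.* p ℕ.+ s) ≈ M Cℤ K * r Cℤ s
  lucas zero zero r s _ _ = ≡⇒≈ (sym (ℤ.*-identityˡ _))
  lucas zero (suc K) r s r<p _ =
    ≡⇒≈ (Cℤ-zero (ℕ.<-≤-trans r<p (ℕ.≤-trans (ℕ.m≤m+n p (K ℕ.* p)) (ℕ.m≤m+n _ s))))
  lucas (suc M) zero r s r<p s<p = begin
    (suc M ℕ.* p ℕ.+ r) Cℤ s          ≡⟨ cong (_Cℤ s) (shift M p r) ⟩
    ((M ℕ.* p ℕ.+ r) ℕ.+ p) Cℤ s      ≈⟨ [m+p]Ct≈mCt (M ℕ.* p ℕ.+ r) s s<p ⟩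
    (M ℕ.* p ℕ.+ r) Cℤ s              ≈⟨ lucas M zero r s r<p s<p ⟩
    1ℤ * r Cℤ s                       ∎
  lucas (suc M) (suc K) r s r<p s<p = begin
    (suc M ℕ.* p ℕ.+ r) Cℤ (suc K ℕ.* p ℕ.+ s)                ≡⟨ cong₂ _Cℤ_ (shift M p r) (shift K p s) ⟩
    (m ℕ.+ p) Cℤ (k ℕ.+ p)                                    ≈⟨ [m+p]C[t+p]≈mC[t+p]+mCt m k ⟩
    m Cℤ (k ℕ.+ p) + m Cℤ k                                   ≡⟨ cong (λ z → m Cℤ z + m Cℤ k) (shift K p s) ⟨
    m Cℤ (suc K ℕ.* p ℕ.+ s) + m Cℤ k                         ≈⟨ +-cong (lucas M (suc K) r s r<p s<p) (lucas M K r s r<p s<p) ⟩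
    M Cℤ suc K * r Cℤ s + M Cℤ K * r Cℤ s                     ≡⟨ factor (M Cℤ suc K) (M Cℤ K) (r Cℤ s) ⟩
    (M Cℤ K + M Cℤ suc K) * r Cℤ s                            ≡⟨ cong (_* r Cℤ s) (pascalℤ M K) ⟨
    suc M Cℤ suc K * r Cℤ s                                   ∎
    where
    m = M ℕ.* p ℕ.+ r
    k = K ℕ.* p ℕ.+ s
    factor : ∀ a b c → a * c + b * c ≡ (b + a) * c
    factor = solve-∀

module CentralBinomial (n : ℕ) (p-prime : Prime (ℕ.suc (n ℕ.+ n))) where

  open import Data.Nat as ℕ using (ℕ; zero; suc)
  import Data.Nat.Properties as ℕ
  import Data.Nat.Tactic.RingSolver as ℕ-Solver
  open import Data.Integer using (ℤ; +_; -_; _+_; _-_; _*_; _^_; 0ℤ; 1ℤ)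
  import Data.Integer.Properties as ℤ
  open import Data.Integer.Tactic.RingSolver using (solve-∀)
  open import Data.Sum using ([_,_]′)
  open import Data.Empty using (⊥-elim)
  open import Function using (id; _∘_)
  open import Relation.Nullary using (yes; no)
  open import Relation.Binary.PropositionalEquality using (_≡_; refl; sym; trans; cong; subst)
  open Binomial using ([k+1]*mC[k+1]≡[m∸k]*mCk; [j+1]*[2j+2]C[j+1]≡2[2j+1]*[2j]Cj)

  open QuadraticResidues n p-prime using (p; 2<p)
  open Congruence p
  open PrimeModulus p p-prime
  open Lucas (n ℕ.+ n) p-prime using (_Cℤ_; Cℤ-zero; lucas)

  -¼ : ℤ
  -¼ = (- + 4) ⁻¹

  -4≉0 : - + 4 ≉ 0ℤ
  -4≉0 -4≈0 = ≉0-* {+ 2} {+ 2} 2≉0 2≉0 (neg-injective (≈-trans -4≈0 (≡⇒≈ refl)))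
    where
    2≉0 : + 2 ≉ 0ℤ
    2≉0 = <p-≉0 (ℕ.s≤s ℕ.z≤n) 2<p

  -4*-¼≈1 : - + 4 * -¼ ≈ 1ℤ
  -4*-¼≈1 = *-inverseʳ -4≉0

  -¼≉0 : -¼ ≉ 0ℤ
  -¼≉0 -¼≈0 = <p-≉0 (ℕ.s≤s ℕ.z≤n) 1<p (≈-trans (≈-sym -4*-¼≈1) (≈-trans (*-congˡ (- + 4) -¼≈0) (≡⇒≈ (ℤ.*-zeroʳ (- + 4)))))

  2[2j+1]*-¼≈n∸j : ∀ j → j ℕ.≤ n → + (2 ℕ.* suc (2 ℕ.* j)) * -¼ ≈ + (n ℕ.∸ j)
  2[2j+1]*-¼≈n∸j j j≤n = begin
    + c * -¼                      ≈⟨ *-congʳ -¼ c≈-4d ⟩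
    (- + 4 * + d) * -¼            ≡⟨ rotate (- + 4) (+ d) -¼ ⟩
    + d * (- + 4 * -¼)            ≈⟨ *-congˡ (+ d) -4*-¼≈1 ⟩
    + d * 1ℤ                      ≡⟨ ℤ.*-identityʳ (+ d) ⟩
    + d                           ∎
    where
    open ≈-Reasoning
    c = 2 ℕ.* suc (2 ℕ.* j)
    d = n ℕ.∸ j
    rotate : ∀ x y z → (x * y) * z ≡ y * (x * z)
    rotate = solve-∀
    c+4d≡2p : c ℕ.+ 4 ℕ.* d ≡ 2 ℕ.* p
    c+4d≡2p = trans (expand d j) (cong (λ z → 2 ℕ.* suc (z ℕ.+ z)) (ℕ.m∸n+n≡m j≤n))
      where
      expand : ∀ d j → 2 ℕ.* (1 ℕ.+ 2 ℕ.* j) ℕ.+ 4 ℕ.* d ≡ 2 ℕ.* (1 ℕ.+ ((d ℕ.+ j) ℕ.+ (d ℕ.+ j)))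
      expand = ℕ-Solver.solve-∀
    c≈-4d : + c ≈ - + 4 * + d
    c≈-4d = begin
      + c                                      ≡⟨ add-sub (+ c) (+ 4 * + d) ⟩
      (+ c + + 4 * + d) - + 4 * + d            ≡⟨ cong (λ z → (+ c + z) - + 4 * + d) (ℤ.pos-* 4 d) ⟨
      (+ c + + (4 ℕ.* d)) - + 4 * + d          ≡⟨ cong (_- + 4 * + d) (ℤ.pos-+ c (4 ℕ.* d)) ⟨
      + (c ℕ.+ 4 ℕ.* d) - + 4 * + d            ≡⟨ cong (λ z → + z - + 4 * + d) c+4d≡2p ⟩
      + (2 ℕ.* p) - + 4 * + d                  ≈⟨ -‿cong (≈-trans (≡⇒≈ (ℤ.pos-* 2 p)) (*-congˡ (+ 2) p≈0)) (≈-refl {+ 4 * + d}) ⟩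
      + 2 * 0ℤ - + 4 * + d                     ≡⟨ zero-sub (+ 4) (+ d) ⟩
      - + 4 * + d                              ∎
      where
      add-sub : ∀ x y → x ≡ (x + y) - y
      add-sub = solve-∀
      zero-sub : ∀ x y → + 2 * 0ℤ - x * y ≡ - x * y
      zero-sub = solve-∀

  -- Both sides c_j satisfy (j + 1) c_{j+1} ≡ (n − j) c_j.
  [2j]Cj*-¼^j≈nCj : ∀ j → j ℕ.< p → (2 ℕ.* j) Cℤ j * -¼ ^ j ≈ n Cℤ j
  [2j]Cj*-¼^j≈nCj zero _ = ≈-refl
  [2j]Cj*-¼^j≈nCj (suc j) j<p = *-cancelˡ (<p-≉0 (ℕ.s≤s ℕ.z≤n) j<p) (begin
    + suc j * ((2 ℕ.* suc j) Cℤ suc j * -¼ ^ suc j)       ≡⟨ regroup (+ suc j) ((2 ℕ.* suc j) Cℤ suc j) -¼ (-¼ ^ j) ⟩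
    (+ suc j * (2 ℕ.* suc j) Cℤ suc j) * -¼ * -¼ ^ j      ≡⟨ cong (λ z → z * -¼ * -¼ ^ j) central-recurrence ⟩
    (+ c * (2 ℕ.* j) Cℤ j) * -¼ * -¼ ^ j                  ≡⟨ interchange (+ c) ((2 ℕ.* j) Cℤ j) -¼ (-¼ ^ j) ⟩
    (+ c * -¼) * ((2 ℕ.* j) Cℤ j * -¼ ^ j)                ≈⟨ *-congˡ (+ c * -¼) ([2j]Cj*-¼^j≈nCj j (ℕ.<-trans (ℕ.n<1+n j) j<p)) ⟩
    (+ c * -¼) * n Cℤ j                                   ≈⟨ factor-cases ⟩
    + (n ℕ.∸ j) * n Cℤ j                                  ≡⟨ descending-absorption ⟩
    + suc j * n Cℤ suc j                                  ∎)
    where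
    open ≈-Reasoning
    c = 2 ℕ.* suc (2 ℕ.* j)
    regroup : ∀ x y w v → x * (y * (w * v)) ≡ (x * y) * w * v
    regroup = solve-∀
    interchange : ∀ x y w v → (x * y) * w * v ≡ (x * w) * (y * v)
    interchange = solve-∀
    central-recurrence : + suc j * (2 ℕ.* suc j) Cℤ suc j ≡ + c * (2 ℕ.* j) Cℤ j
    central-recurrence = trans (sym (ℤ.pos-* (suc j) _))
      (trans (cong +_ ([j+1]*[2j+2]C[j+1]≡2[2j+1]*[2j]Cj j)) (ℤ.pos-* c _))
    descending-absorption : + (n ℕ.∸ j) * n Cℤ j ≡ + suc j * n Cℤ suc j
    descending-absorption = trans (sym (ℤ.pos-* (n ℕ.∸ j) _))
      (trans (cong +_ (sym ([k+1]*mC[k+1]≡[m∸k]*mCk n j))) (ℤ.pos-* (suc j) _))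
    factor-cases : (+ c * -¼) * n Cℤ j ≈ + (n ℕ.∸ j) * n Cℤ j
    factor-cases with j ℕ.≤? n
    ... | yes j≤n = *-congʳ (n Cℤ j) (2[2j+1]*-¼≈n∸j j j≤n)
    ... | no j≰n = ≡⇒≈ (trans (cong ((+ c * -¼) *_) nCj≡0) (trans (ℤ.*-zeroʳ (+ c * -¼)) (sym (trans (cong (+ (n ℕ.∸ j) *_) nCj≡0) (ℤ.*-zeroʳ (+ (n ℕ.∸ j)))))))
      where
      nCj≡0 : n Cℤ j ≡ 0ℤ
      nCj≡0 = Cℤ-zero (ℕ.≰⇒> j≰n)

  [2j]Cj≈0 : ∀ j → n ℕ.< j → j ℕ.< p → (2 ℕ.* j) Cℤ j ≈ 0ℤ
  [2j]Cj≈0 j n<j j<p = [ id , ⊥-elim ∘ ≉0-^ j -¼≉0 ]′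
    (≈0-euclid ((2 ℕ.* j) Cℤ j) (-¼ ^ j) (≈-trans ([2j]Cj*-¼^j≈nCj j j<p) (≡⇒≈ (Cℤ-zero n<j))))

  central-lucas : ∀ k j → j ℕ.< p → (2 ℕ.* (k ℕ.* p ℕ.+ j)) Cℤ (k ℕ.* p ℕ.+ j) ≈ (2 ℕ.* k) Cℤ k * (2 ℕ.* j) Cℤ j
  central-lucas k j j<p with j ℕ.≤? n
  ... | yes j≤n = ≈-trans (≡⇒≈ (cong (_Cℤ (k ℕ.* p ℕ.+ j)) (double k p j)))
                          (lucas (2 ℕ.* k) k (2 ℕ.* j) j 2j<p j<p)
    where
    double : ∀ k p j → 2 ℕ.* (k ℕ.* p ℕ.+ j) ≡ (2 ℕ.* k) ℕ.* p ℕ.+ 2 ℕ.* j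
    double = ℕ-Solver.solve-∀
    2j<p : 2 ℕ.* j ℕ.< p
    2j<p = ℕ.s≤s (ℕ.+-mono-≤ j≤n (subst (ℕ._≤ n) (sym (ℕ.+-identityʳ j)) j≤n))
  ... | no j≰n = begin
    (2 ℕ.* (k ℕ.* p ℕ.+ j)) Cℤ (k ℕ.* p ℕ.+ j)     ≡⟨ cong (_Cℤ (k ℕ.* p ℕ.+ j)) carry ⟩
    (suc (2 ℕ.* k) ℕ.* p ℕ.+ e) Cℤ (k ℕ.* p ℕ.+ j) ≈⟨ lucas (suc (2 ℕ.* k)) k e j e<p j<p ⟩
    suc (2 ℕ.* k) Cℤ k * e Cℤ j                    ≡⟨ cong (suc (2 ℕ.* k) Cℤ k *_) (Cℤ-zero e<j) ⟩
    suc (2 ℕ.* k) Cℤ k * 0ℤ                        ≡⟨ ℤ.*-zeroʳ (suc (2 ℕ.* k) Cℤ k) ⟩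
    0ℤ                                             ≡⟨ ℤ.*-zeroʳ ((2 ℕ.* k) Cℤ k) ⟨
    (2 ℕ.* k) Cℤ k * 0ℤ                            ≈⟨ *-congˡ ((2 ℕ.* k) Cℤ k) ([2j]Cj≈0 j n<j j<p) ⟨
    (2 ℕ.* k) Cℤ k * (2 ℕ.* j) Cℤ j                ∎
    where
    open ≈-Reasoning
    n<j = ℕ.≰⇒> j≰n
    p≤2j : p ℕ.≤ 2 ℕ.* j
    p≤2j = ℕ.+-mono-≤ n<j (subst (n ℕ.≤_) (sym (ℕ.+-identityʳ j)) (ℕ.<⇒≤ n<j))
    e = 2 ℕ.* j ℕ.∸ p
    e+p≡2j : e ℕ.+ p ≡ 2 ℕ.* j
    e+p≡2j = ℕ.m∸n+n≡m p≤2j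
    e<j : e ℕ.< j
    e<j = ℕ.+-cancelʳ-< p e j (subst (ℕ._< j ℕ.+ p) (sym e+p≡2j)
            (subst (ℕ._< j ℕ.+ p) (cong (j ℕ.+_) (sym (ℕ.+-identityʳ j))) (ℕ.+-monoʳ-< j j<p)))
    e<p : e ℕ.< p
    e<p = ℕ.<-trans e<j j<p
    carry : 2 ℕ.* (k ℕ.* p ℕ.+ j) ≡ suc (2 ℕ.* k) ℕ.* p ℕ.+ e
    carry = trans (double k p j) (trans (cong (λ z → 2 ℕ.* k ℕ.* p ℕ.+ z) (sym e+p≡2j)) (regroup k p e))
      where
      double : ∀ k p j → 2 ℕ.* (k ℕ.* p ℕ.+ j) ≡ 2 ℕ.* k ℕ.* p ℕ.+ 2 ℕ.* j
      double = ℕ-Solver.solve-∀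
      regroup : ∀ k p e → 2 ℕ.* k ℕ.* p ℕ.+ (e ℕ.+ p) ≡ (1 ℕ.+ 2 ℕ.* k) ℕ.* p ℕ.+ e
      regroup = ℕ-Solver.solve-∀

module CentralBinomialSums (n : ℕ) (p-prime : Prime (ℕ.suc (n ℕ.+ n))) (h : ℕ) (1≤h : 1 ℕ.≤ h) where

  open import Data.Nat as ℕ using (ℕ; suc)
  import Data.Nat.Properties as ℕ
  open import Data.Nat.Combinatorics using (nCk≡nC[n∸k])
  open import Data.Integer using (ℤ; +_; _+_; _*_; _^_; 0ℤ; 1ℤ)
  import Data.Integer.Properties as ℤ
  open import Data.Integer.Tactic.RingSolver using (solve-∀)
  open import Relation.Binary.PropositionalEquality using (_≡_; trans; cong)
  open IntegerSums
  open QuadraticResidues n p-prime using (p; fermat)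
  open Congruence p
  open Lucas (n ℕ.+ n) p-prime using (_Cℤ_; Cℤ-zero)
  open CentralBinomial n p-prime using (-¼; [2j]Cj*-¼^j≈nCj; central-lucas)

  b : ℕ → ℤ
  b k = (2 ℕ.* k) Cℤ k * -¼ ^ k

  term : ℤ → ℕ → ℤ
  term t k = b k ^ h * t ^ k

  b-digits : ∀ k j → j ℕ.< p → b (k ℕ.* p ℕ.+ j) ≈ b k * b j
  b-digits k j j<p = ≈-trans (*-cong (central-lucas k j j<p) (^-digits p (fermat -¼) k j))
    (≡⇒≈ (interchange ((2 ℕ.* k) Cℤ k) ((2 ℕ.* j) Cℤ j) (-¼ ^ k) (-¼ ^ j)))
    where
    interchange : ∀ a c w v → (a * c) * (w * v) ≡ (a * w) * (c * v)
    interchange = solve-∀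

  term-digits : ∀ {t} → t ^ p ≈ t → ∀ k j → j ℕ.< p → term t (k ℕ.* p ℕ.+ j) ≈ term t k * term t j
  term-digits {t} t^p≈t k j j<p = begin
    b (k ℕ.* p ℕ.+ j) ^ h * t ^ (k ℕ.* p ℕ.+ j) ≈⟨ *-cong (^-cong h (b-digits k j j<p)) (^-digits p t^p≈t k j) ⟩
    (b k * b j) ^ h * (t ^ k * t ^ j)           ≡⟨ cong (_* (t ^ k * t ^ j)) (^-distrib-* (b k) (b j) h) ⟩
    (b k ^ h * b j ^ h) * (t ^ k * t ^ j)       ≡⟨ interchange (b k ^ h) (b j ^ h) (t ^ k) (t ^ j) ⟩
    (b k ^ h * t ^ k) * (b j ^ h * t ^ j)       ∎
    where
    open ≈-Reasoning
    interchange : ∀ a c w v → (a * c) * (w * v) ≡ (a * w) * (c * v)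
    interchange = solve-∀

  ∑-term-p^a : ∀ {t} → t ^ p ≈ t → ∀ a → ∑ (p ℕ.^ a) (term t) ≈ ∑ p (term t) ^ a
  ∑-term-p^a {t} t^p≈t = ∑-digit-multiplicative p (term t) term-0≈1 (term-digits t^p≈t)
    where
    term-0≈1 : term t 0 ≈ 1ℤ
    term-0≈1 = ≡⇒≈ (trans (ℤ.*-identityʳ (1ℤ ^ h)) (ℤ.^-zeroˡ h))

  F : ℤ → ℤ
  F t = ∑ (suc n) (λ j → n Cℤ j ^ h * t ^ j)

  ∑-term-p≈F : ∀ t → ∑ p (term t) ≈ F t
  ∑-term-p≈F t = begin
    ∑ p (term t)                                  ≈⟨ ∑-cong p (λ j j<p → *-congʳ (t ^ j) (^-cong h ([2j]Cj*-¼^j≈nCj j j<p))) ⟩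
    ∑ p f                                         ≡⟨ ∑-split (suc n) n f ⟩
    F t + ∑ n (λ i → f (suc n ℕ.+ i))             ≡⟨ cong (λ z → F t + z) (∑-zero n _ (λ i _ → f-vanishes i)) ⟩
    F t + 0ℤ                                      ≡⟨ ℤ.+-identityʳ (F t) ⟩
    F t                                           ∎
    where
    open ≈-Reasoning
    f = λ j → n Cℤ j ^ h * t ^ j
    0^h≡0 : 0ℤ ^ h ≡ 0ℤ
    0^h≡0 = zero-power 1≤h
      where
      zero-power : ∀ {k} → 1 ℕ.≤ k → 0ℤ ^ k ≡ 0ℤ
      zero-power {suc k} _ = ℤ.*-zeroˡ (0ℤ ^ k)
    f-vanishes : ∀ i → f (suc n ℕ.+ i) ≡ 0ℤ
    f-vanishes i = trans (cong (λ w → w ^ h * t ^ (suc n ℕ.+ i)) (Cℤ-zero {n} {suc n ℕ.+ i} (ℕ.s≤s (ℕ.m≤m+n n i))))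
                         (trans (cong (_* t ^ (suc n ℕ.+ i)) 0^h≡0) (ℤ.*-zeroˡ (t ^ (suc n ℕ.+ i))))

  F-palindromic : ∀ {t s} → t * s ≈ 1ℤ → t ^ n * F s ≈ F t
  F-palindromic {t} {s} ts≈1 = begin
    t ^ n * F s                                   ≡⟨ ∑-*ˡ (suc n) (t ^ n) (λ j → n Cℤ j ^ h * s ^ j) ⟩
    ∑ (suc n) (λ j → t ^ n * (n Cℤ j ^ h * s ^ j)) ≈⟨ ∑-cong (suc n) (λ j j<1+n → reflect j (ℕ.≤-pred j<1+n)) ⟩
    ∑ (suc n) (λ j → f (n ℕ.∸ j))                 ≡⟨ ∑-reverse n f ⟨
    F t                                           ∎
    where
    open ≈-Reasoning
    f = λ j → n Cℤ j ^ h * t ^ j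
    reflect : ∀ j → j ℕ.≤ n → t ^ n * (n Cℤ j ^ h * s ^ j) ≈ f (n ℕ.∸ j)
    reflect j j≤n = begin
      t ^ n * (n Cℤ j ^ h * s ^ j)                   ≡⟨ cong (λ e → t ^ e * (n Cℤ j ^ h * s ^ j)) (ℕ.m∸n+n≡m j≤n) ⟨
      t ^ (n ℕ.∸ j ℕ.+ j) * (n Cℤ j ^ h * s ^ j)     ≡⟨ cong (_* (n Cℤ j ^ h * s ^ j)) (ℤ.^-distribˡ-+-* t (n ℕ.∸ j) j) ⟩
      (t ^ (n ℕ.∸ j) * t ^ j) * (n Cℤ j ^ h * s ^ j) ≡⟨ regroup (t ^ (n ℕ.∸ j)) (t ^ j) (n Cℤ j ^ h) (s ^ j) ⟩
      n Cℤ j ^ h * t ^ (n ℕ.∸ j) * (t ^ j * s ^ j)   ≡⟨ cong (n Cℤ j ^ h * t ^ (n ℕ.∸ j) *_) (^-distrib-* t s j) ⟨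
      n Cℤ j ^ h * t ^ (n ℕ.∸ j) * (t * s) ^ j       ≈⟨ *-congˡ (n Cℤ j ^ h * t ^ (n ℕ.∸ j)) (^-cong j ts≈1) ⟩
      n Cℤ j ^ h * t ^ (n ℕ.∸ j) * 1ℤ ^ j            ≡⟨ cong (n Cℤ j ^ h * t ^ (n ℕ.∸ j) *_) (ℤ.^-zeroˡ j) ⟩
      n Cℤ j ^ h * t ^ (n ℕ.∸ j) * 1ℤ                ≡⟨ ℤ.*-identityʳ _ ⟩
      n Cℤ j ^ h * t ^ (n ℕ.∸ j)                     ≡⟨ cong (λ c → (+ c) ^ h * t ^ (n ℕ.∸ j)) (nCk≡nC[n∸k] j≤n) ⟩
      f (n ℕ.∸ j)                                    ∎
      where
      regroup : ∀ a c d e → (a * c) * (d * e) ≡ d * a * (c * e)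
      regroup = solve-∀

  ∑-term≈F^a : ∀ t a → ∑ (p ℕ.^ a) (term t) ≈ F t ^ a
  ∑-term≈F^a t a = ≈-trans (∑-term-p^a (fermat t) a) (^-cong a (∑-term-p≈F t))

module LucasSequences (p : ℕ) where

  open import Data.Nat as ℕ using (ℕ; zero; suc)
  open import Data.Integer using (ℤ; +_; -_; _+_; _-_; _*_; _^_; 0ℤ; 1ℤ)
  open import Data.Integer.Tactic.RingSolver using (solve-∀)
  open import Data.Product using (_×_; _,_; proj₁; proj₂)
  open import Relation.Binary.PropositionalEquality using (_≡_; refl; sym)
  open import Defs using (lucasU; lucasV)
  open Congruence p

  module Binet {A B α β : ℤ} (A≈α+β : A ≈ α + β) (B≈αβ : B ≈ α * β) where

    binet : ∀ (w : ℕ → ℤ) c d → (∀ k → w (suc (suc k)) ≡ A * w (suc k) - B * w k) →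
            w 0 ≈ c + d → w 1 ≈ c * α + d * β → ∀ k → w k ≈ c * α ^ k + d * β ^ k
    binet w c d recurrence w0 w1 k = proj₁ (consecutive k)
      where
      f : ℕ → ℤ
      f k = c * α ^ k + d * β ^ k
      consecutive : ∀ k → w k ≈ f k × w (suc k) ≈ f (suc k)
      consecutive zero = ≈-trans w0 (≡⇒≈ (at-0 c d)) , ≈-trans w1 (≡⇒≈ (at-1 c d α β))
        where
        at-0 : ∀ c d → c + d ≡ c * 1ℤ + d * 1ℤ
        at-0 = solve-∀
        at-1 : ∀ c d α β → c * α + d * β ≡ c * (α * 1ℤ) + d * (β * 1ℤ)
        at-1 = solve-∀
      consecutive (suc k) = proj₂ IH , (begin
        w (suc (suc k))                         ≡⟨ recurrence k ⟩
        A * w (suc k) - B * w k                 ≈⟨ -‿cong (*-cong A≈α+β (proj₂ IH)) (*-cong B≈αβ (proj₁ IH)) ⟩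
        (α + β) * f (suc k) - (α * β) * f k     ≡⟨ step c d α β (α ^ k) (β ^ k) ⟩
        f (suc (suc k))                         ∎)
        where
        open ≈-Reasoning
        IH = consecutive k
        step : ∀ c d α β x y → (α + β) * (c * (α * x) + d * (β * y)) - (α * β) * (c * x + d * y)
                               ≡ c * (α * (α * x)) + d * (β * (β * y))
        step = solve-∀

    lucasU-binet : ∀ k → (α - β) * lucasU A B k ≈ α ^ k - β ^ k
    lucasU-binet k = ≈-trans (binet (λ k → (α - β) * lucasU A B k) 1ℤ (- 1ℤ) recurrence
                                     (≡⇒≈ (at-0 α β)) (≡⇒≈ (at-1 α β)) k)
                             (≡⇒≈ (signs (α ^ k) (β ^ k)))
      where
      distribute : ∀ d A B u v → d * (A * u - B * v) ≡ A * (d * u) - B * (d * v)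
      distribute = solve-∀
      recurrence : ∀ k → (α - β) * lucasU A B (suc (suc k)) ≡ A * ((α - β) * lucasU A B (suc k)) - B * ((α - β) * lucasU A B k)
      recurrence k = distribute (α - β) A B (lucasU A B (suc k)) (lucasU A B k)
      at-0 : ∀ α β → (α - β) * 0ℤ ≡ 1ℤ + - 1ℤ
      at-0 = solve-∀
      at-1 : ∀ α β → (α - β) * 1ℤ ≡ 1ℤ * α + - 1ℤ * β
      at-1 = solve-∀
      signs : ∀ x y → 1ℤ * x + - 1ℤ * y ≡ x - y
      signs = solve-∀

    lucasV-binet : ∀ k → lucasV A B k ≈ α ^ k + β ^ k
    lucasV-binet k = ≈-trans (binet (lucasV A B) 1ℤ 1ℤ (λ _ → refl) ≈-refl (≈-trans A≈α+β (≡⇒≈ (unit α β))) k) (≡⇒≈ (sym (unit (α ^ k) (β ^ k))))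
      where
      unit : ∀ x y → x + y ≡ 1ℤ * x + 1ℤ * y
      unit = solve-∀

module RationalResidues (p : ℕ) (p-prime : Prime p) where

  open import Data.Nat as ℕ using (ℕ; zero; suc)
  open import Data.Integer using (ℤ; +_; _+_; _*_; 0ℤ; 1ℤ)
  import Data.Integer.Properties as ℤ
  open import Data.Integer.Divisibility.Signed using (∣⇒∣ᵤ)
  open import Data.Integer.Tactic.RingSolver using (solve-∀)
  open import Data.Product using (_×_; _,_; ∃)
  open import Data.Rational as ℚ using (ℚ; 0ℚ)
  import Data.Rational.Properties as ℚ
  open import Function using (_∘_)
  open import Relation.Binary.PropositionalEquality using (_≡_; _≢_; refl; trans; cong)
  open import Defs using (frac; sumTo; ≡0modℚ)
  open IntegerSums using (∑)
  open Fractions using (≡frac; frac-+)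
  open Congruence p
  open PrimeModulus p p-prime

  -- s is the image of q under the reduction map from the rationals with denominator prime to p.
  HasResidue : ℚ → ℤ → Set
  HasResidue q s = ∃ λ a → ∃ λ b → b ≉ 0ℤ × q ≡ frac a b × a ≈ s * b

  private
    ≉0⇒≢0 : ∀ {b} → b ≉ 0ℤ → b ≢ 0ℤ
    ≉0⇒≢0 b≉0 = b≉0 ∘ ≡⇒≈

  sumTo-residue : ∀ N (num den : ℕ → ℤ) → (∀ k → den k ≉ 0ℤ) →
                  HasResidue (sumTo N (λ k → frac (num k) (den k))) (∑ N (λ k → num k * den k ⁻¹))
  sumTo-residue zero num den den≉0 = 0ℤ , 1ℤ , <p-≉0 (ℕ.s≤s ℕ.z≤n) 1<p , ≡frac 0ℚ 0ℤ {1ℤ} (λ ()) refl , ≈-refl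
  sumTo-residue (suc N) num den den≉0 with sumTo-residue N num den den≉0
  ... | a , b , b≉0 , q≡a/b , a≈sb =
    a * d + c * b , b * d , ≉0-* b≉0 (den≉0 N) ,
    trans (cong (ℚ._+ frac c d) q≡a/b) (frac-+ a c (≉0⇒≢0 b≉0) (≉0⇒≢0 (den≉0 N))) ,
    (begin
      a * d + c * b                     ≈⟨ +-cong (*-congʳ d a≈sb) (≈-refl {c * b}) ⟩
      (s * b) * d + c * b               ≡⟨ cong (λ z → (s * b) * d + z) (ℤ.*-identityʳ (c * b)) ⟨
      (s * b) * d + (c * b) * 1ℤ        ≈⟨ +-cong (≈-refl {(s * b) * d}) (*-congˡ (c * b) (*-inverseʳ (den≉0 N))) ⟨
      (s * b) * d + (c * b) * (d * d ⁻¹) ≡⟨ factor s b c d (d ⁻¹) ⟩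
      (s + c * d ⁻¹) * (b * d)          ∎)
    where
    open ≈-Reasoning
    c = num N
    d = den N
    s = ∑ N (λ k → num k * den k ⁻¹)
    factor : ∀ s b c d i → (s * b) * d + (c * b) * (d * i) ≡ (s + c * i) * (b * d)
    factor = solve-∀

  residue≈0⇒≡0modℚ : ∀ {q s} → HasResidue q s → s ≈ 0ℤ → ≡0modℚ q p
  residue≈0⇒≡0modℚ (a , b , b≉0 , q≡a/b , a≈sb) s≈0 =
    a , b , b≉0 ∘ ∣ᵤ⇒≈0 , ∣⇒∣ᵤ (≈0⇒∣ (≈-trans a≈sb (≈-trans (*-congʳ b s≈0) (≡⇒≈ (ℤ.*-zeroˡ b))))) , ℚ.≡⇒≃ q≡a/b

module LucasSums (n : ℕ) (p-prime : Prime (ℕ.suc (n ℕ.+ n))) (h : ℕ) (1≤h : 1 ℕ.≤ h) (A m δ : ℤ) where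

  open import Data.Nat as ℕ using (ℕ; suc)
  import Data.Nat.Properties as ℕ
  open import Data.Nat.Combinatorics using (_C_)
  open import Data.Integer using (ℤ; +_; -_; _+_; _-_; _*_; _^_; 0ℤ; 1ℤ)
  import Data.Integer.Properties as ℤ
  open import Data.Integer.Tactic.RingSolver using (solve-∀)
  import Data.Nat.Tactic.RingSolver as ℕ-Solver
  open import Data.Sum using ([_,_]′)
  open import Data.Empty using (⊥-elim)
  open import Function using (_∘_; id)
  open import Relation.Binary.PropositionalEquality using (_≡_; refl; sym; trans; cong; cong₂)
  open import Defs using (lucasU; lucasV; legendre; jacobiPrimePow)
  open IntegerSums
  open QuadraticResidues n p-prime using (p; 2<p; euler-criterion; square-^-half)
  open Congruence p
  open PrimeModulus p p-prime
  open Lucas (n ℕ.+ n) p-prime using (_Cℤ_)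
  open CentralBinomial n p-prime using (-¼; -4≉0; -4*-¼≈1)
  open LucasSequences p using (module Binet)
  open CentralBinomialSums n p-prime h 1≤h using (term; F; ∑-term≈F^a; F-palindromic)

  ½ : ℤ
  ½ = + suc n

  2*½≈1 : + 2 * ½ ≈ 1ℤ
  2*½≈1 = ≈-trans (≡⇒≈ (trans (sym (ℤ.pos-* 2 (suc n))) (trans (cong +_ (double-suc n)) (ℤ.pos-+ p 1))))
                  (≈-trans (+-cong p≈0 (≈-refl {1ℤ})) (≡⇒≈ refl))
    where
    double-suc : ∀ n → 2 ℕ.* suc n ≡ suc (n ℕ.+ n) ℕ.+ 1
    double-suc = ℕ-Solver.solve-∀

  α β : ℤ
  α = (A + δ) * ½
  β = (A - δ) * ½

  private
    *2*½ : ∀ z → z * (+ 2 * ½) ≈ z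
    *2*½ z = ≈-trans (*-congˡ z 2*½≈1) (≡⇒≈ (ℤ.*-identityʳ z))

  A≈α+β : A ≈ α + β
  A≈α+β = ≈-sym (≈-trans (≡⇒≈ (sum A δ ½)) (*2*½ A))
    where
    sum : ∀ A d i → (A + d) * i + (A - d) * i ≡ A * (+ 2 * i)
    sum = solve-∀

  α-β≈δ : α - β ≈ δ
  α-β≈δ = ≈-trans (≡⇒≈ (difference A δ ½)) (*2*½ δ)
    where
    difference : ∀ A d i → (A + d) * i - (A - d) * i ≡ d * (+ 2 * i)
    difference = solve-∀

  numeratorU numeratorV den : ℕ → ℤ
  numeratorU k = lucasU A (m * m) k * (2 ℕ.* k) Cℤ k ^ h
  numeratorV k = lucasV A (m * m) k * (2 ℕ.* k) Cℤ k ^ h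
  den k = m ^ k * (- + 4) ^ (h ℕ.* k)

  module Nondegenerate (δ²≈D : δ * δ ≈ A * A - + 4 * m * m) (D≉0 : A * A - + 4 * m * m ≉ 0ℤ) (m≉0 : m ≉ 0ℤ)
    where

    m*m≈α*β : m * m ≈ α * β
    m*m≈α*β = ≈-sym (begin
      α * β                                              ≡⟨ product A δ ½ ⟩
      (A * A - δ * δ) * (½ * ½)                          ≈⟨ *-congʳ (½ * ½) (-‿cong (≈-refl {A * A}) δ²≈D) ⟩
      (A * A - (A * A - + 4 * m * m)) * (½ * ½)          ≡⟨ cancel A m ½ ⟩
      (m * m) * (+ 2 * ½) * (+ 2 * ½)                    ≈⟨ *2*½ ((m * m) * (+ 2 * ½)) ⟩
      (m * m) * (+ 2 * ½)                                ≈⟨ *2*½ (m * m) ⟩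
      m * m                                              ∎)
      where
      open ≈-Reasoning
      product : ∀ A d i → (A + d) * i * ((A - d) * i) ≡ (A * A - d * d) * (i * i)
      product = solve-∀
      cancel : ∀ A m i → (A * A - (A * A - + 4 * m * m)) * (i * i) ≡ (m * m) * (+ 2 * i) * (+ 2 * i)
      cancel = solve-∀

    x y : ℤ
    x = α * m ⁻¹
    y = β * m ⁻¹

    x*y≈1 : x * y ≈ 1ℤ
    x*y≈1 = begin
      α * m ⁻¹ * (β * m ⁻¹)          ≡⟨ regroup α β (m ⁻¹) ⟩
      (α * β) * (m ⁻¹ * m ⁻¹)        ≈⟨ *-congʳ (m ⁻¹ * m ⁻¹) m*m≈α*β ⟨
      (m * m) * (m ⁻¹ * m ⁻¹)        ≡⟨ interchange m (m ⁻¹) ⟩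
      (m * m ⁻¹) * (m * m ⁻¹)        ≈⟨ *-cong (*-inverseʳ m≉0) (*-inverseʳ m≉0) ⟩
      1ℤ                             ∎
      where
      open ≈-Reasoning
      regroup : ∀ a b c → a * c * (b * c) ≡ (a * b) * (c * c)
      regroup = solve-∀
      interchange : ∀ a c → (a * a) * (c * c) ≡ (a * c) * (a * c)
      interchange = solve-∀

    2m*x≈A+δ : (+ 2 * m) * x ≈ A + δ
    2m*x≈A+δ = begin
      (+ 2 * m) * ((A + δ) * ½ * m ⁻¹)    ≡⟨ regroup A δ ½ m (m ⁻¹) ⟩
      ((A + δ) * (+ 2 * ½)) * (m * m ⁻¹)  ≈⟨ *-cong (*2*½ (A + δ)) (*-inverseʳ m≉0) ⟩
      (A + δ) * 1ℤ                        ≡⟨ ℤ.*-identityʳ (A + δ) ⟩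
      A + δ                               ∎
      where
      open ≈-Reasoning
      regroup : ∀ A d i m M → (+ 2 * m) * ((A + d) * i * M) ≡ ((A + d) * (+ 2 * i)) * (m * M)
      regroup = solve-∀

    ∑-term-x≈x^na*∑-term-y : ∀ a → ∑ (p ℕ.^ a) (term x) ≈ (x ^ n) ^ a * ∑ (p ℕ.^ a) (term y)
    ∑-term-x≈x^na*∑-term-y a = begin
      ∑ (p ℕ.^ a) (term x)               ≈⟨ ∑-term≈F^a x a ⟩
      F x ^ a                            ≈⟨ ^-cong a (F-palindromic x*y≈1) ⟨
      (x ^ n * F y) ^ a                  ≡⟨ ^-distrib-* (x ^ n) (F y) a ⟩
      (x ^ n) ^ a * F y ^ a              ≈⟨ *-congˡ ((x ^ n) ^ a) (∑-term≈F^a y a) ⟨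
      (x ^ n) ^ a * ∑ (p ℕ.^ a) (term y) ∎
      where open ≈-Reasoning

    2m≉0 : + 2 * m ≉ 0ℤ
    2m≉0 = ≉0-* (<p-≉0 (ℕ.s≤s ℕ.z≤n) 2<p) m≉0

    ℓ ℓ′ : ℤ
    ℓ = legendre (+ 2 * m) p
    ℓ′ = legendre (A + δ) p

    ℓ*x^n≈ℓ′ : ℓ * x ^ n ≈ ℓ′
    ℓ*x^n≈ℓ′ = begin
      ℓ * x ^ n                ≈⟨ *-congʳ (x ^ n) (euler-criterion (+ 2 * m)) ⟨
      (+ 2 * m) ^ n * x ^ n    ≡⟨ ^-distrib-* (+ 2 * m) x n ⟨
      ((+ 2 * m) * x) ^ n      ≈⟨ ^-cong n 2m*x≈A+δ ⟩
      (A + δ) ^ n              ≈⟨ euler-criterion (A + δ) ⟩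
      ℓ′                       ∎
      where open ≈-Reasoning

    ℓ^a*ℓ^a≈1 : ∀ a → ℓ ^ a * ℓ ^ a ≈ 1ℤ
    ℓ^a*ℓ^a≈1 a = begin
      ℓ ^ a * ℓ ^ a                          ≡⟨ ^-distrib-* ℓ ℓ a ⟨
      (ℓ * ℓ) ^ a                            ≈⟨ ^-cong a (*-cong (euler-criterion (+ 2 * m)) (euler-criterion (+ 2 * m))) ⟨
      ((+ 2 * m) ^ n * (+ 2 * m) ^ n) ^ a    ≡⟨ cong (_^ a) (^-distrib-* (+ 2 * m) (+ 2 * m) n) ⟨
      (((+ 2 * m) * (+ 2 * m)) ^ n) ^ a      ≈⟨ ^-cong a (square-^-half 2m≉0) ⟩
      1ℤ ^ a                                 ≡⟨ ℤ.^-zeroˡ a ⟩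
      1ℤ                                     ∎
      where open ≈-Reasoning

    x^na≈ℓ^a*ℓ′^a : ∀ a → (x ^ n) ^ a ≈ ℓ ^ a * ℓ′ ^ a
    x^na≈ℓ^a*ℓ′^a a = begin
      (x ^ n) ^ a                            ≡⟨ ℤ.*-identityˡ ((x ^ n) ^ a) ⟨
      1ℤ * (x ^ n) ^ a                       ≈⟨ *-congʳ ((x ^ n) ^ a) (ℓ^a*ℓ^a≈1 a) ⟨
      (ℓ ^ a * ℓ ^ a) * (x ^ n) ^ a          ≡⟨ ℤ.*-assoc (ℓ ^ a) (ℓ ^ a) ((x ^ n) ^ a) ⟩
      ℓ ^ a * (ℓ ^ a * (x ^ n) ^ a)          ≡⟨ cong (ℓ ^ a *_) (^-distrib-* ℓ (x ^ n) a) ⟨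
      ℓ ^ a * (ℓ * x ^ n) ^ a                ≈⟨ *-congˡ (ℓ ^ a) (^-cong a ℓ*x^n≈ℓ′) ⟩
      ℓ ^ a * ℓ′ ^ a                         ∎
      where open ≈-Reasoning

    x^na≈1 : ∀ a → jacobiPrimePow (A + δ) p a ≡ jacobiPrimePow (+ 2 * m) p a → (x ^ n) ^ a ≈ 1ℤ
    x^na≈1 a ℓ′^a≡ℓ^a = ≈-trans (x^na≈ℓ^a*ℓ′^a a) (≈-trans (≡⇒≈ (cong (ℓ ^ a *_) ℓ′^a≡ℓ^a)) (ℓ^a*ℓ^a≈1 a))

    x^na≈-1 : ∀ a → jacobiPrimePow (A + δ) p a ≡ - jacobiPrimePow (+ 2 * m) p a → (x ^ n) ^ a ≈ - 1ℤ
    x^na≈-1 a ℓ′^a≡-ℓ^a = ≈-trans (x^na≈ℓ^a*ℓ′^a a)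
      (≈-trans (≡⇒≈ (trans (cong (ℓ ^ a *_) ℓ′^a≡-ℓ^a) (sym (ℤ.neg-distribʳ-* (ℓ ^ a) (ℓ ^ a))))) (neg-cong (ℓ^a*ℓ^a≈1 a)))

    den≉0 : ∀ k → den k ≉ 0ℤ
    den≉0 k = ≉0-* (≉0-^ k m≉0) (≉0-^ (h ℕ.* k) -4≉0)

    den⁻¹ : ∀ k → den k ⁻¹ ≈ m ⁻¹ ^ k * -¼ ^ (h ℕ.* k)
    den⁻¹ k = ⁻¹-unique (den≉0 k) (begin
      (m ^ k * (- + 4) ^ hk) * (m ⁻¹ ^ k * -¼ ^ hk)      ≡⟨ interchange (m ^ k) ((- + 4) ^ hk) (m ⁻¹ ^ k) (-¼ ^ hk) ⟩
      (m ^ k * m ⁻¹ ^ k) * ((- + 4) ^ hk * -¼ ^ hk)      ≡⟨ cong₂ _*_ (^-distrib-* m (m ⁻¹) k) (^-distrib-* (- + 4) -¼ hk) ⟨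
      (m * m ⁻¹) ^ k * ((- + 4) * -¼) ^ hk               ≈⟨ *-cong (^-cong k (*-inverseʳ m≉0)) (^-cong hk -4*-¼≈1) ⟩
      1ℤ ^ k * 1ℤ ^ hk                                   ≡⟨ cong₂ _*_ (ℤ.^-zeroˡ k) (ℤ.^-zeroˡ hk) ⟩
      1ℤ                                                 ∎)
      where
      open ≈-Reasoning
      hk = h ℕ.* k
      interchange : ∀ a b c d → (a * b) * (c * d) ≡ (a * c) * (b * d)
      interchange = solve-∀

    open Binet {A} {m * m} {α} {β} A≈α+β m*m≈α*β

    δ≉0 : δ ≉ 0ℤ
    δ≉0 δ≈0 = D≉0 (≈-trans (≈-sym δ²≈D) (*-cong δ≈0 δ≈0))

    private
      coefficient : ℕ → ℤ
      coefficient k = (2 ℕ.* k) Cℤ k ^ h * -¼ ^ (h ℕ.* k)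

      term-scaled : ∀ γ k → term (γ * m ⁻¹) k ≡ coefficient k * (γ ^ k * m ⁻¹ ^ k)
      term-scaled γ k = cong₂ _*_
        (trans (^-distrib-* ((2 ℕ.* k) Cℤ k) (-¼ ^ k) h)
               (cong ((2 ℕ.* k) Cℤ k ^ h *_) (trans (ℤ.^-*-assoc -¼ k h) (cong (-¼ ^_) (ℕ.*-comm k h)))))
        (^-distrib-* γ (m ⁻¹) k)

    lucasU-term : ∀ k → (α - β) * (numeratorU k * den k ⁻¹) ≈ term x k - term y k
    lucasU-term k = begin
      (α - β) * (U * c * den k ⁻¹)                   ≡⟨ regroup (α - β) U c (den k ⁻¹) ⟩
      ((α - β) * U) * c * den k ⁻¹                   ≈⟨ *-cong (*-congʳ c (lucasU-binet k)) (den⁻¹ k) ⟩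
      (α ^ k - β ^ k) * c * (m ⁻¹ ^ k * w)           ≡⟨ distribute (α ^ k) (β ^ k) c (m ⁻¹ ^ k) w ⟩
      (c * w) * (α ^ k * m ⁻¹ ^ k) - (c * w) * (β ^ k * m ⁻¹ ^ k) ≡⟨ cong₂ _-_ (term-scaled α k) (term-scaled β k) ⟨
      term x k - term y k                            ∎
      where
      open ≈-Reasoning
      U = lucasU A (m * m) k
      c = (2 ℕ.* k) Cℤ k ^ h
      w = -¼ ^ (h ℕ.* k)
      regroup : ∀ d u c i → d * (u * c * i) ≡ (d * u) * c * i
      regroup = solve-∀
      distribute : ∀ a b c M w → (a - b) * c * (M * w) ≡ (c * w) * (a * M) - (c * w) * (b * M)
      distribute = solve-∀

    lucasV-term : ∀ k → numeratorV k * den k ⁻¹ ≈ term x k + term y k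
    lucasV-term k = begin
      V * c * den k ⁻¹                               ≈⟨ *-cong (*-congʳ c (lucasV-binet k)) (den⁻¹ k) ⟩
      (α ^ k + β ^ k) * c * (m ⁻¹ ^ k * w)           ≡⟨ distribute (α ^ k) (β ^ k) c (m ⁻¹ ^ k) w ⟩
      (c * w) * (α ^ k * m ⁻¹ ^ k) + (c * w) * (β ^ k * m ⁻¹ ^ k) ≡⟨ cong₂ _+_ (term-scaled α k) (term-scaled β k) ⟨
      term x k + term y k                            ∎
      where
      open ≈-Reasoning
      V = lucasV A (m * m) k
      c = (2 ℕ.* k) Cℤ k ^ h
      w = -¼ ^ (h ℕ.* k)
      distribute : ∀ a b c M w → (a + b) * c * (M * w) ≡ (c * w) * (a * M) + (c * w) * (b * M)
      distribute = solve-∀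

    ∑-lucasU≈0 : ∀ a → jacobiPrimePow (A + δ) p a ≡ jacobiPrimePow (+ 2 * m) p a →
                 ∑ (p ℕ.^ a) (λ k → numeratorU k * den k ⁻¹) ≈ 0ℤ
    ∑-lucasU≈0 a jacobi≡ = [ ⊥-elim ∘ δ≉0 , id ]′ (≈0-euclid δ S (begin
      δ * S                                          ≈⟨ *-congʳ S α-β≈δ ⟨
      (α - β) * S                                    ≡⟨ ∑-*ˡ N (α - β) f ⟩
      ∑ N (λ k → (α - β) * f k)                      ≈⟨ ∑-cong N (λ k _ → lucasU-term k) ⟩
      ∑ N (λ k → term x k - term y k)                ≡⟨ ∑-- N (term x) (term y) ⟩
      ∑ N (term x) - ∑ N (term y)                    ≈⟨ -‿cong (∑-term-x≈x^na*∑-term-y a) (≈-refl {∑ N (term y)}) ⟩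
      (x ^ n) ^ a * ∑ N (term y) - ∑ N (term y)      ≈⟨ -‿cong (*-congʳ (∑ N (term y)) (x^na≈1 a jacobi≡)) (≈-refl {∑ N (term y)}) ⟩
      1ℤ * ∑ N (term y) - ∑ N (term y)               ≡⟨ cancel (∑ N (term y)) ⟩
      0ℤ                                             ∎))
      where
      open ≈-Reasoning
      N = p ℕ.^ a
      f = λ k → numeratorU k * den k ⁻¹
      S = ∑ N f
      cancel : ∀ z → 1ℤ * z - z ≡ 0ℤ
      cancel = solve-∀

    ∑-lucasV≈0 : ∀ a → jacobiPrimePow (A + δ) p a ≡ - jacobiPrimePow (+ 2 * m) p a →
                 ∑ (p ℕ.^ a) (λ k → numeratorV k * den k ⁻¹) ≈ 0ℤ
    ∑-lucasV≈0 a jacobi≡- = begin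
      ∑ N (λ k → numeratorV k * den k ⁻¹)            ≈⟨ ∑-cong N (λ k _ → lucasV-term k) ⟩
      ∑ N (λ k → term x k + term y k)                ≡⟨ ∑-+ N (term x) (term y) ⟩
      ∑ N (term x) + ∑ N (term y)                    ≈⟨ +-cong (∑-term-x≈x^na*∑-term-y a) (≈-refl {∑ N (term y)}) ⟩
      (x ^ n) ^ a * ∑ N (term y) + ∑ N (term y)      ≈⟨ +-cong (*-congʳ (∑ N (term y)) (x^na≈-1 a jacobi≡-)) (≈-refl {∑ N (term y)}) ⟩
      - 1ℤ * ∑ N (term y) + ∑ N (term y)             ≡⟨ cancel (∑ N (term y)) ⟩
      0ℤ                                             ∎
      where
      open ≈-Reasoning
      N = p ℕ.^ a
      cancel : ∀ z → - 1ℤ * z + z ≡ 0ℤ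
      cancel = solve-∀

open import Defs
open import Data.Nat using (_≤_)
open import Data.Nat.Combinatorics using (_C_)
open import Data.Integer using (+_; -_; _-_; _*_; _^_)
open import Data.Integer.Divisibility using (_∣_)
open import Data.Integer.Divisibility.Signed using (∣ᵤ⇒∣)
import Data.Nat.Divisibility as ℕ
import Data.Nat.DivMod as ℕ
open import Data.Nat.Primality using (prime⇒irreducible)
open import Data.Product using (_×_; _,_; ∃)
open import Data.Sum using (inj₁; inj₂)
open import Data.Empty using (⊥-elim)
open import Relation.Nullary using (¬_)
open import Relation.Binary.PropositionalEquality using (_≡_; _≢_; refl; sym; trans; cong)
import Data.Nat.Tactic.RingSolver as ℕ-Solver

odd-prime : ∀ {p} → Prime p → p ≢ 2 → ∃ λ n → p ≡ ℕ.suc (n ℕ.+ n)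
odd-prime {p} p-prime p≢2 = by-remainder (p ℕ.% 2) (ℕ.m%n<n p 2) refl
  where
  by-remainder : ∀ r → r ℕ.< 2 → p ℕ.% 2 ≡ r → ∃ λ n → p ≡ ℕ.suc (n ℕ.+ n)
  by-remainder 0 _ p%2≡0 with prime⇒irreducible p-prime (ℕ.m%n≡0⇒n∣m p 2 p%2≡0)
  ... | inj₁ ()
  ... | inj₂ 2≡p = ⊥-elim (p≢2 (sym 2≡p))
  by-remainder 1 _ p%2≡1 = p ℕ./ 2 , trans (ℕ.m≡m%n+[m/n]*n p 2) (trans (cong (ℕ._+ (p ℕ./ 2) ℕ.* 2) p%2≡1) (halve (p ℕ./ 2)))
    where
    halve : ∀ q → 1 ℕ.+ q ℕ.* 2 ≡ 1 ℕ.+ (q ℕ.+ q)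
    halve = ℕ-Solver.solve-∀
  by-remainder (ℕ.suc (ℕ.suc r)) (ℕ.s≤s (ℕ.s≤s ())) _

theorem1p1 : (A m δ : ℤ) (p a h : ℕ) → Prime p → p ≢ 2 → ¬ (+ p ∣ m)
  → (+ p ∣ (δ * δ - (A * A - + 4 * m * m))) → ¬ (+ p ∣ (A * A - + 4 * m * m))
  → 1 ≤ a → 1 ≤ h
  → (jacobiPrimePow (A ℤ.+ δ) p a ≡ jacobiPrimePow (+ 2 * m) p a
      → ≡0modℚ (sumTo (p ℕ.^ a) (λ k →
          frac (lucasU A (m * m) k * (+ ((2 ℕ.* k) C k)) ^ h)
               (m ^ k * (- (+ 4)) ^ (h ℕ.* k)))) p)
  × (jacobiPrimePow (A ℤ.+ δ) p a ≡ - jacobiPrimePow (+ 2 * m) p a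
      → ≡0modℚ (sumTo (p ℕ.^ a) (λ k →
          frac (lucasV A (m * m) k * (+ ((2 ℕ.* k) C k)) ^ h)
               (m ^ k * (- (+ 4)) ^ (h ℕ.* k)))) p)
theorem1p1 A m δ p a h p-prime p≢2 p∤m p∣δ²-D p∤D _ 1≤h with odd-prime p-prime p≢2
... | n , refl =
  (λ jacobi≡ → residue≈0⇒≡0modℚ (sumTo-residue (p ℕ.^ a) numeratorU den den≉0) (∑-lucasU≈0 a jacobi≡)) ,
  (λ jacobi≡- → residue≈0⇒≡0modℚ (sumTo-residue (p ℕ.^ a) numeratorV den den≉0) (∑-lucasV≈0 a jacobi≡-))
  where
  open Congruence p using (mk≈; ∤ᵤ⇒≉0)
  open RationalResidues p p-prime
  open LucasSums n p-prime h 1≤h A m δ using (numeratorU; numeratorV; den)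
  open LucasSums.Nondegenerate n p-prime h 1≤h A m δ (mk≈ (∣ᵤ⇒∣ p∣δ²-D)) (∤ᵤ⇒≉0 p∤D) (∤ᵤ⇒≉0 p∤m)
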